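{- If $G$ is $5$-Ore and $R\subsetneq V(G)$ is such that $|R|\ge 5$ and $p_{KY}(R)<12$, then $R$ is collapsible and $p_{KY}(R)=9$.
   Context: All graphs are finite and simple. An Ore-composition of $G_1$ and $G_2$: delete an edge $xy$ of $G_1$, split a vertex $z$ of $G_2$ into two vertices $z_1,z_2$ of positive degree, identify $x$ with $z_1$ and $y$ with $z_2$. A graph is $5$-Ore if obtainable from copies of $K_5$ by repeated Ore-compositions ($5$-Ore graphs are $5$-critical, i.e. not $4$-colorable but every proper subgraph is $4$-colorable). The Kostochka–Yancey potential is $p_{KY}(G)=9|V(G)|-4|E(G)|$ and $p_{KY}(R)=p_{KY}(G[R])$. The boundary of $R$ is the set of vertices of $R$ with a neighbor outside $R$. For a $5$-critical $G$, $R\subsetneq V(G)$ with $|R|\ge5$ is collapsible if in every $4$-coloring of $G[R]$ all boundary vertices of $R$ receive the same color. -}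

module Defs where

open import Data.Nat using (ℕ; zero; suc; _+_; _*_; _≤_)
open import Data.Bool using (Bool; true; false; if_then_else_; _∧_)
open import Data.Fin using (Fin; _<?_; punchIn)
open import Data.List using (List; map; concatMap; allFin)
open import Data.Nat.ListAction using (sum)
open import Data.Fin.Subset using (Subset; _∈_; _∉_; ∣_∣; _⊂_; ⊤)
open import Data.Vec using (lookup)
open import Data.Integer using (ℤ; +_; _-_)
open import Data.Product using (Σ; ∃; _×_; _,_)
open import Data.Sum using (_⊎_)
open import Relation.Nullary using (¬_; ⌊_⌋)
open import Relation.Binary.PropositionalEquality using (_≡_; _≢_)
open import Function.Bundles using (_⇔_)

record Graph (n : ℕ) : Set where
  field
    adj    : Fin n → Fin n → Bool
    sym    : ∀ u v → adj u v ≡ adj v u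
    irrefl : ∀ u → adj u u ≡ false
open Graph public

Adj : ∀ {n} → Graph n → Fin n → Fin n → Set
Adj G u v = adj G u v ≡ true

IsK5 : Graph 5 → Set
IsK5 G = ∀ u v → u ≢ v → Adj G u v

-- H is (isomorphic to) an Ore-composition of G1 and G2:
-- delete edge xy of G1, split vertex z of G2 into z1,z2 (z1 gets the neighbours
-- w of z with side w ≡ true, z2 those with side w ≡ false, both nonempty),
-- identify x with z1 and y with z2.  The vertices of G2 other than z are
-- indexed by  punchIn z : Fin m → Fin (suc m).  f and g embed the two parts into H,
-- jointly bijectively.
record OreComp {n₁ m n : ℕ} (G₁ : Graph n₁) (G₂ : Graph (suc m)) (H : Graph n) : Set where
  field
    x y   : Fin n₁
    xy-edge : Adj G₁ x y
    z     : Fin (suc m)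
    side  : Fin m → Bool
    f     : Fin n₁ → Fin n
    g     : Fin m → Fin n
    f-inj : ∀ u u' → f u ≡ f u' → u ≡ u'
    g-inj : ∀ w w' → g w ≡ g w' → w ≡ w'
    fg-disj : ∀ u w → f u ≢ g w
    fg-cover : ∀ v → (∃ λ u → f u ≡ v) ⊎ (∃ λ w → g w ≡ v)
    adj-ff : ∀ u u' → Adj H (f u) (f u') ⇔
               (Adj G₁ u u' × ¬ ((u ≡ x × u' ≡ y) ⊎ (u ≡ y × u' ≡ x)))
    adj-gg : ∀ w w' → adj H (g w) (g w') ≡ adj G₂ (punchIn z w) (punchIn z w')
    adj-gf : ∀ w u → Adj H (g w) (f u) ⇔
               (Adj G₂ (punchIn z w) z × ((u ≡ x × side w ≡ true) ⊎ (u ≡ y × side w ≡ false)))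
    z₁-pos : ∃ λ w → Adj G₂ (punchIn z w) z × side w ≡ true
    z₂-pos : ∃ λ w → Adj G₂ (punchIn z w) z × side w ≡ false

data Is5Ore : {n : ℕ} → Graph n → Set where
  k5  : (G : Graph 5) → IsK5 G → Is5Ore G
  ore : ∀ {n₁ m n} {G₁ : Graph n₁} {G₂ : Graph (suc m)} {H : Graph n} →
        Is5Ore G₁ → Is5Ore G₂ → OreComp G₁ G₂ H → Is5Ore H

edgesIn : ∀ {n} → Graph n → Subset n → ℕ
edgesIn {n} G R = sum (concatMap (λ u → map (λ v →
  if ⌊ u <? v ⌋ ∧ lookup R u ∧ lookup R v ∧ adj G u v then 1 else 0) (allFin n)) (allFin n))

pKY : ∀ {n} → Graph n → Subset n → ℤ
pKY G R = + (9 * ∣ R ∣) - + (4 * edgesIn G R)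

Proper4ColoringOf : ∀ {n} → Graph n → Subset n → (Fin n → Fin 4) → Set
Proper4ColoringOf G R c = ∀ u v → u ∈ R → v ∈ R → Adj G u v → c u ≢ c v

InBoundary : ∀ {n} → Graph n → Subset n → Fin n → Set
InBoundary G R u = u ∈ R × ∃ λ w → w ∉ R × Adj G u w

Collapsible : ∀ {n} → Graph n → Subset n → Set
Collapsible G R = R ⊂ ⊤ × 5 ≤ ∣ R ∣ ×
  (∀ c → Proper4ColoringOf G R c → ∀ u v → InBoundary G R u → InBoundary G R v → c u ≡ c v)

module Submission where

-- By induction on the Ore construction every 5-Ore graph G satisfies a
-- stronger invariant (KYInvariant): G is not 4-colourable, p(V(G)) = 5, and every
-- non-empty proper vertex set r satisfies the Dichotomy "p(r) = 9 and r is
-- collapsible, or p(r) ≥ 12".  The theorem is this dichotomy for R, whose second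
-- alternative is excluded by p_KY(R) < 12.
--   * Vertex sets are characteristic functions Fin n → Bool, and p is recomputed
--     from sums of indicators over Fin n (pKY≡pot).
--   * Base case: the 30 non-empty proper subsets of K5 are enumerated.
--   * Step: for an Ore-composition H of G₁, G₂ and a vertex set r of H with traces
--     r₁ in G₁ and r₂ in G₂ (z ∈ r₂ iff x ∈ r or y ∈ r) the potential identity
--       p(r) + 9[z ∈ r₂] = p(r₁) + p(r₂) + 4([x, y ∈ r] + #lost edges at z)
--     holds; a case analysis on whether x, y ∈ r and on how r meets the two sides
--     gives the dichotomy for r, transferring colourings and boundaries of r to r₁
--     or r₂ and using that G₁, G₂ are not 4-colourable.

open import Defs hiding (sym)
open import Data.Nat using (ℕ; _≤_)
open import Data.Fin.Subset using (Subset; ∣_∣; _⊂_; ⊤)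
open import Data.Integer using (+_; _<_)
open import Data.Product using (_×_)
open import Relation.Binary.PropositionalEquality using (_≡_)

open import Data.Bool using (Bool; true; false; if_then_else_; _∧_; _∨_; not)
import Data.Bool.Properties as Bool
open import Data.Bool.Properties using (∧-zeroʳ; ∧-identityʳ; ¬-not; ⇔→≡; not-involutive)
open import Data.Empty using (⊥; ⊥-elim)
open import Data.Fin using (Fin; zero; suc; punchIn; punchOut; splitAt; join; _↑ˡ_; _↑ʳ_; _<?_; _≟_)
open import Data.Fin.Permutation using (Permutation; permutation)
open import Data.Fin.Properties
  using (punchInᵢ≢i; punchIn-punchOut; punchIn-injective; splitAt-↑ˡ; splitAt-↑ʳ; join-splitAt;
         <-cmp; pigeonhole; <⇒≢; any?)
open import Data.Fin.Subset using (_∈_; _∉_)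
open import Data.Integer using (ℤ)
import Data.Integer as Z
open import Data.Integer.Properties using (pos-+; pos-*; <⇒≱; i≤i+j)
open import Data.Integer.Tactic.RingSolver using (solve-∀)
open import Data.List using (List; map; concatMap; tabulate)
open import Data.Nat using (zero; suc; _+_; _*_; z≤n; s≤s)
open import Data.Nat.ListAction using () renaming (sum to listSum)
open import Data.Nat.ListAction.Properties using () renaming (sum-++ to listSum-++)
open import Data.Nat.Properties
  using (+-0-commutativeMonoid; +-assoc; +-comm; +-identityʳ; +-monoʳ-≤; m≤m+n; n≤0⇒n≡0; ≤-trans;
         *-assoc; *-suc)
open import Algebra.Properties.CommutativeMonoid.Sum +-0-commutativeMonoid
  using (sum; sum-cong-≗; sum-replicate-zero; sum-remove; ∑-permute; ∑-distrib-+; ∑-comm)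
import Data.Nat.Tactic.RingSolver as ℕ-Ring
open import Data.Product using (∃; _,_; proj₁; proj₂)
open import Data.Sum using (_⊎_; inj₁; inj₂; [_,_]′)
open import Data.Vec using (Vec; lookup; []; _∷_)
import Data.Vec as Vec
open import Data.Vec.Functional using (insertAt)
open import Data.Vec.Functional.Properties using (insertAt-lookup; insertAt-punchIn)
open import Data.Vec.Properties using (lookup∘tabulate; lookup⇒[]=; []=⇒lookup)
open import Function using (_∘_; id)
open import Function.Bundles using (Equivalence; mk⇔)
open import Relation.Binary using (tri<; tri≈; tri>)
open import Relation.Binary.PropositionalEquality
  using (_≢_; refl; sym; trans; cong; cong₂; subst; module ≡-Reasoning)
open import Relation.Nullary using (Dec; ¬_; ⌊_⌋; yes; no)
open import Relation.Nullary.Decidable using (isYes≗does; dec-true; dec-false; _×-dec_; _⊎-dec_)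

sum-zero : ∀ {n} (φ : Fin n → ℕ) → (∀ i → φ i ≡ 0) → sum φ ≡ 0
sum-zero {n} φ φ≡0 = trans (sum-cong-≗ φ≡0) (sum-replicate-zero n)

term≤sum : ∀ {n} (φ : Fin n → ℕ) (i : Fin n) → φ i ≤ sum φ
term≤sum {suc n} φ i = subst (φ i ≤_) (sym (sum-remove {i = i} φ)) (m≤m+n (φ i) _)

sum≡0⇒term≡0 : ∀ {n} (φ : Fin n → ℕ) → sum φ ≡ 0 → ∀ i → φ i ≡ 0
sum≡0⇒term≡0 φ s≡0 i = n≤0⇒n≡0 (subst (φ i ≤_) s≡0 (term≤sum φ i))

two-terms≤sum : ∀ {n} (φ : Fin n → ℕ) (i j : Fin n) → i ≢ j → φ i + φ j ≤ sum φ
two-terms≤sum {suc n} φ i j i≢j =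
  subst (φ i + φ j ≤_) (sym (sum-remove {i = i} φ))
    (+-monoʳ-≤ (φ i) (subst (_≤ sum (φ ∘ punchIn i)) (cong φ (punchIn-punchOut i≢j))
      (term≤sum (φ ∘ punchIn i) (punchOut i≢j))))

sum-single : ∀ {n} (φ : Fin n → ℕ) (i : Fin n) → (∀ j → j ≢ i → φ j ≡ 0) → sum φ ≡ φ i
sum-single {suc n} φ i others≡0 = begin
  sum φ                        ≡⟨ sum-remove {i = i} φ ⟩
  φ i + sum (φ ∘ punchIn i)    ≡⟨ cong (_+_ (φ i)) (sum-zero _ (λ j → others≡0 _ (punchInᵢ≢i i j))) ⟩
  φ i + 0                      ≡⟨ +-identityʳ (φ i) ⟩
  φ i                          ∎
  where open ≡-Reasoning

sum-pair : ∀ {n} (φ : Fin n → ℕ) (i j : Fin n) → i ≢ j →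
           (∀ k → k ≢ i → k ≢ j → φ k ≡ 0) → sum φ ≡ φ i + φ j
sum-pair {suc n} φ i j i≢j others≡0 = begin
  sum φ                                ≡⟨ sum-remove {i = i} φ ⟩
  φ i + sum (φ ∘ punchIn i)            ≡⟨ cong (_+_ (φ i)) (sum-single _ (punchOut i≢j) rest≡0) ⟩
  φ i + φ (punchIn i (punchOut i≢j))   ≡⟨ cong (λ k → φ i + φ k) (punchIn-punchOut i≢j) ⟩
  φ i + φ j                            ∎
  where
  open ≡-Reasoning
  rest≡0 : ∀ k → k ≢ punchOut i≢j → φ (punchIn i k) ≡ 0
  rest≡0 k k≢ = others≡0 _ (punchInᵢ≢i i k) λ eq →
    k≢ (punchIn-injective i k _ (trans eq (sym (punchIn-punchOut i≢j))))

sum-splitAt : ∀ a {b} (ψ : Fin (a + b) → ℕ) →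
              sum ψ ≡ sum (λ i → ψ (i ↑ˡ b)) + sum (λ j → ψ (a ↑ʳ j))
sum-splitAt zero    ψ = refl
sum-splitAt (suc a) ψ = trans (cong (_+_ (ψ zero)) (sum-splitAt a (ψ ∘ suc))) (sym (+-assoc (ψ zero) _ _))

sum-partition : ∀ {k l n} (f : Fin k → Fin n) (g : Fin l → Fin n) →
  (∀ u u' → f u ≡ f u' → u ≡ u') → (∀ w w' → g w ≡ g w' → w ≡ w') → (∀ u w → f u ≢ g w) →
  (∀ v → (∃ λ u → f u ≡ v) ⊎ (∃ λ w → g w ≡ v)) →
  (φ : Fin n → ℕ) → sum φ ≡ sum (φ ∘ f) + sum (φ ∘ g)
sum-partition {k} {l} {n} f g f-inj g-inj disjoint cover φ = begin
  sum φ                                              ≡⟨ ∑-permute φ π ⟩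
  sum (φ ∘ h)                                        ≡⟨ sum-splitAt k (φ ∘ h) ⟩
  sum (λ i → φ (h (i ↑ˡ l))) + sum (λ j → φ (h (k ↑ʳ j)))
    ≡⟨ cong₂ _+_ (sum-cong-≗ (λ u → cong (φ ∘ [ f , g ]′) (splitAt-↑ˡ k u l)))
                 (sum-cong-≗ (λ w → cong (φ ∘ [ f , g ]′) (splitAt-↑ʳ k l w))) ⟩
  sum (φ ∘ f) + sum (φ ∘ g)                          ∎
  where
  open ≡-Reasoning
  h : Fin (k + l) → Fin n
  h i = [ f , g ]′ (splitAt k i)
  h⁻¹ : Fin n → Fin (k + l)
  h⁻¹ v with cover v
  ... | inj₁ (u , _) = u ↑ˡ l
  ... | inj₂ (w , _) = k ↑ʳ w
  h∘h⁻¹ : ∀ v → h (h⁻¹ v) ≡ v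
  h∘h⁻¹ v with cover v
  ... | inj₁ (u , fu≡v) = trans (cong [ f , g ]′ (splitAt-↑ˡ k u l)) fu≡v
  ... | inj₂ (w , gw≡v) = trans (cong [ f , g ]′ (splitAt-↑ʳ k l w)) gw≡v
  h⁻¹∘h : ∀ i → h⁻¹ (h i) ≡ i
  h⁻¹∘h i = h-injective (h∘h⁻¹ (h i))
    where
    copair-injective : ∀ s t → [ f , g ]′ s ≡ [ f , g ]′ t → s ≡ t
    copair-injective (inj₁ u) (inj₁ u') eq = cong inj₁ (f-inj u u' eq)
    copair-injective (inj₁ u) (inj₂ w)  eq = ⊥-elim (disjoint u w eq)
    copair-injective (inj₂ w) (inj₁ u)  eq = ⊥-elim (disjoint u w (sym eq))
    copair-injective (inj₂ w) (inj₂ w') eq = cong inj₂ (g-inj w w' eq)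
    h-injective : ∀ {i j} → h i ≡ h j → i ≡ j
    h-injective {i} {j} eq = begin
      i                      ≡⟨ join-splitAt k l i ⟨
      join k l (splitAt k i) ≡⟨ cong (join k l) (copair-injective (splitAt k i) (splitAt k j) eq) ⟩
      join k l (splitAt k j) ≡⟨ join-splitAt k l j ⟩
      j                      ∎
  π : Permutation (k + l) n
  π = permutation h h⁻¹ h∘h⁻¹ h⁻¹∘h

𝟙 : Bool → ℕ
𝟙 b = if b then 1 else 0

size : ∀ {n} → (Fin n → Bool) → ℕ
size r = sum (𝟙 ∘ r)

-- The number of ordered adjacent pairs inside r, i.e. twice |E(G[r])|.
degSum : ∀ {n} → (Fin n → Fin n → Bool) → (Fin n → Bool) → ℕ
degSum A r = sum λ u → sum λ v → 𝟙 (r u ∧ r v ∧ A u v)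

pot : ∀ {n} → (Fin n → Fin n → Bool) → (Fin n → Bool) → ℤ
pot A r = + (9 * size r) Z.- + (2 * degSum A r)

size-lookup : ∀ {n} (R : Subset n) → ∣ R ∣ ≡ size (lookup R)
size-lookup []          = refl
size-lookup (true ∷ R)  = cong suc (size-lookup R)
size-lookup (false ∷ R) = size-lookup R

listSum-map-tabulate : ∀ {n} {A : Set} (g : Fin n → A) (h : A → ℕ) →
                       listSum (map h (tabulate g)) ≡ sum (h ∘ g)
listSum-map-tabulate {zero}  g h = refl
listSum-map-tabulate {suc n} g h = cong (_+_ (h (g zero))) (listSum-map-tabulate (g ∘ suc) h)

listSum-concatMap-tabulate : ∀ {n} {A : Set} (g : Fin n → A) (F : A → List ℕ) →
                             listSum (concatMap F (tabulate g)) ≡ sum (λ i → listSum (F (g i)))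
listSum-concatMap-tabulate {zero}  g F = refl
listSum-concatMap-tabulate {suc n} g F =
  trans (listSum-++ (F (g zero)) _) (cong (_+_ (listSum (F (g zero)))) (listSum-concatMap-tabulate (g ∘ suc) F))

upperEdge : ∀ {n} → (Fin n → Fin n → Bool) → (Fin n → Bool) → Fin n → Fin n → ℕ
upperEdge A r u v = 𝟙 (⌊ u <? v ⌋ ∧ r u ∧ r v ∧ A u v)

edgesIn-as-sum : ∀ {n} (G : Graph n) (R : Subset n) →
                 edgesIn G R ≡ sum λ u → sum λ v → upperEdge (adj G) (lookup R) u v
edgesIn-as-sum {n} G R =
  trans (listSum-concatMap-tabulate id (λ u → map (E u) (tabulate id)))
        (sum-cong-≗ λ u → listSum-map-tabulate id (E u))
  where
  E : Fin n → Fin n → ℕ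
  E = upperEdge (adj G) (lookup R)

⌊⌋-true : ∀ {P : Set} (p? : Dec P) → P → ⌊ p? ⌋ ≡ true
⌊⌋-true p? p = trans (isYes≗does p?) (dec-true p? p)

⌊⌋-false : ∀ {P : Set} (p? : Dec P) → ¬ P → ⌊ p? ⌋ ≡ false
⌊⌋-false p? ¬p = trans (isYes≗does p?) (dec-false p? ¬p)

∧-swap : ∀ x y a → (x ∧ y ∧ a) ≡ (y ∧ x ∧ a)
∧-swap true  true  a = refl
∧-swap true  false a = refl
∧-swap false true  a = refl
∧-swap false false a = refl

edge-sym : ∀ {n} (G : Graph n) (r : Fin n → Bool) u v →
           (r u ∧ r v ∧ adj G u v) ≡ (r v ∧ r u ∧ adj G v u)
edge-sym G r u v = trans (∧-swap (r u) (r v) _) (cong (λ t → r v ∧ r u ∧ t) (Graph.sym G u v))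

pair-split : ∀ {n} (G : Graph n) (r : Fin n → Bool) u v →
             𝟙 (r u ∧ r v ∧ adj G u v) ≡ upperEdge (adj G) r u v + upperEdge (adj G) r v u
pair-split G r u v with <-cmp u v
... | tri< u<v _ v≮u rewrite ⌊⌋-true (u <? v) u<v | ⌊⌋-false (v <? u) v≮u =
  sym (+-identityʳ _)
... | tri> u≮v _ v<u rewrite ⌊⌋-true (v <? u) v<u | ⌊⌋-false (u <? v) u≮v =
  cong 𝟙 (edge-sym G r u v)
... | tri≈ _ refl _ rewrite Graph.irrefl G u | ∧-zeroʳ (r u) | ∧-zeroʳ (r u) | ∧-zeroʳ ⌊ u <? u ⌋ = refl

degSum≡2*edgesIn : ∀ {n} (G : Graph n) (R : Subset n) → degSum (adj G) (lookup R) ≡ 2 * edgesIn G R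
degSum≡2*edgesIn {n} G R = begin
  degSum (adj G) r
    ≡⟨ sum-cong-≗ (λ u → trans (sum-cong-≗ (pair-split G r u)) (∑-distrib-+ (E u) (λ v → E v u))) ⟩
  sum (λ u → sum (E u) + sum (λ v → E v u))
    ≡⟨ ∑-distrib-+ (λ u → sum (E u)) (λ u → sum (λ v → E v u)) ⟩
  Eₛ + sum (λ u → sum (λ v → E v u))   ≡⟨ cong (_+_ Eₛ) (∑-comm (λ u v → E v u)) ⟩
  Eₛ + Eₛ                              ≡⟨ cong (_+_ Eₛ) (sym (+-identityʳ Eₛ)) ⟩
  2 * Eₛ                               ≡⟨ cong (2 *_) (edgesIn-as-sum G R) ⟨
  2 * edgesIn G R                      ∎
  where
  open ≡-Reasoning
  r : Fin n → Bool
  r = lookup R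
  E : Fin n → Fin n → ℕ
  E = upperEdge (adj G) r
  Eₛ : ℕ
  Eₛ = sum λ u → sum (E u)

pKY≡pot : ∀ {n} (G : Graph n) (R : Subset n) → pKY G R ≡ pot (adj G) (lookup R)
pKY≡pot G R rewrite size-lookup R | degSum≡2*edgesIn G R | *-assoc 2 2 (edgesIn G R) = refl

AtLeast12 : ℤ → Set
AtLeast12 P = ∃ λ d → P ≡ + 12 Z.+ + d

-- The potentials a proper non-empty vertex set of a 5-Ore graph can have.
Admissible : ℤ → Set
Admissible P = P ≡ + 9 ⊎ AtLeast12 P

InBd : ∀ {n} → Graph n → (Fin n → Bool) → Fin n → Set
InBd G r u = r u ≡ true × ∃ λ w → r w ≡ false × Adj G u w

ProperOn : ∀ {n} → Graph n → (Fin n → Bool) → (Fin n → Fin 4) → Set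
ProperOn G r c = ∀ u v → r u ≡ true → r v ≡ true → Adj G u v → c u ≢ c v

CollapsibleOn : ∀ {n} → Graph n → (Fin n → Bool) → Set
CollapsibleOn G r = ∀ c → ProperOn G r c → ∀ u v → InBd G r u → InBd G r v → c u ≡ c v

Dichotomy : ∀ {n} → Graph n → (Fin n → Bool) → Set
Dichotomy G r = (pot (adj G) r ≡ + 9 × CollapsibleOn G r) ⊎ AtLeast12 (pot (adj G) r)

record KYInvariant {n} (G : Graph n) : Set where
  field
    uncolourable : ∀ (c : Fin n → Fin 4) → (∀ u v → Adj G u v → c u ≢ c v) → ⊥
    pot-whole    : pot (adj G) (λ _ → true) ≡ + 5
    pot-proper   : ∀ r → (∃ λ v → r v ≡ false) → (∃ λ v → r v ≡ true) → Dichotomy G r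

pot-cong : ∀ {n} {A B : Fin n → Fin n → Bool} {r s : Fin n → Bool} →
           (∀ u v → A u v ≡ B u v) → (∀ v → r v ≡ s v) → pot A r ≡ pot B s
pot-cong A≡B r≡s = cong₂ (λ k l → + (9 * k) Z.- + (2 * l))
  (sum-cong-≗ (cong 𝟙 ∘ r≡s))
  (sum-cong-≗ λ u → sum-cong-≗ λ v → cong 𝟙 (cong₂ _∧_ (r≡s u) (cong₂ _∧_ (r≡s v) (A≡B u v))))

size-one-unique : ∀ {n} (r : Fin n → Bool) → size r ≡ 1 → ∀ {u v} → r u ≡ true → r v ≡ true → u ≡ v
size-one-unique r size≡1 {u} {v} ru rv with u ≟ v
... | yes u≡v = u≡v
... | no  u≢v with subst (λ t → 𝟙 (r u) + 𝟙 (r v) ≤ t) size≡1 (two-terms≤sum (𝟙 ∘ r) u v u≢v)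
...   | le rewrite ru | rv with le
...     | s≤s ()

size-one-collapsible : ∀ {n} (G : Graph n) (r : Fin n → Bool) → size r ≡ 1 → CollapsibleOn G r
size-one-collapsible G r size≡1 c _ u v bu bv = cong c (size-one-unique r size≡1 (proj₁ bu) (proj₁ bv))

empty-or-member : ∀ {n} (r : Fin n → Bool) → (∀ v → r v ≡ false) ⊎ (∃ λ v → r v ≡ true)
empty-or-member r with any? (λ v → r v Bool.≟ true)
... | yes member = inj₂ member
... | no  none   = inj₁ λ v → ¬-not λ rv → none (v , rv)

full-or-nonmember : ∀ {n} (r : Fin n → Bool) → (∀ v → r v ≡ true) ⊎ (∃ λ v → r v ≡ false)
full-or-nonmember r with any? (λ v → r v Bool.≟ false)
... | yes nonmember = inj₂ nonmember
... | no  none      = inj₁ λ v → ¬-not λ rv → none (v , rv)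

pot-empty : ∀ {n} (A : Fin n → Fin n → Bool) (r : Fin n → Bool) → (∀ v → r v ≡ false) → pot A r ≡ + 0
pot-empty A r empty = cong₂ (λ k l → + (9 * k) Z.- + (2 * l))
  (sum-zero _ (cong 𝟙 ∘ empty)) (sum-zero _ λ u → sum-zero _ λ v → cong (λ t → 𝟙 (t ∧ r v ∧ A u v)) (empty u))

pot-full : ∀ {n} {G : Graph n} → KYInvariant G → ∀ r → (∀ v → r v ≡ true) → pot (adj G) r ≡ + 5
pot-full I r full = trans (pot-cong {r = r} (λ _ _ → refl) full) (KYInvariant.pot-whole I)

dichotomy⇒admissible : ∀ {n} (G : Graph n) r → Dichotomy G r → Admissible (pot (adj G) r)
dichotomy⇒admissible _ _ (inj₁ (pot≡9 , _)) = inj₁ pot≡9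
dichotomy⇒admissible _ _ (inj₂ atLeast12)    = inj₂ atLeast12

9≢12+ : ∀ d → + 9 ≢ + 12 Z.+ + d
9≢12+ d ()

1≢0 : 1 ≢ 0
1≢0 ()

dichotomy-at-9 : ∀ {n} (G : Graph n) r → Dichotomy G r → pot (adj G) r ≡ + 9 → CollapsibleOn G r
dichotomy-at-9 _ _ (inj₁ (_ , collapsible)) _     = collapsible
dichotomy-at-9 _ _ (inj₂ (d , pot≡))        pot≡9 = ⊥-elim (9≢12+ d (trans (sym pot≡9) pot≡))

K5adj : Fin 5 → Fin 5 → Bool
K5adj u v = not ⌊ u ≟ v ⌋

IsK5⇒K5adj : (G : Graph 5) → IsK5 G → ∀ u v → adj G u v ≡ K5adj u v
IsK5⇒K5adj G complete u v with u ≟ v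
... | yes refl = Graph.irrefl G u
... | no  u≢v  = complete u v u≢v

-- All 30 non-empty proper subsets of K5, by enumeration: singletons have
-- potential 9, all others (2, 3 or 4 vertices) potential 14, 15 or 12.
K5-dichotomy : ∀ (bs : Vec Bool 5) → let r = lookup bs in
  (∃ λ v → r v ≡ false) → (∃ λ v → r v ≡ true) →
  (pot K5adj r ≡ + 9 × size r ≡ 1) ⊎ AtLeast12 (pot K5adj r)
K5-dichotomy (false ∷ false ∷ false ∷ false ∷ false ∷ []) _ (zero , ())
K5-dichotomy (false ∷ false ∷ false ∷ false ∷ false ∷ []) _ (suc zero , ())
K5-dichotomy (false ∷ false ∷ false ∷ false ∷ false ∷ []) _ (suc (suc zero) , ())
K5-dichotomy (false ∷ false ∷ false ∷ false ∷ false ∷ []) _ (suc (suc (suc zero)) , ())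
K5-dichotomy (false ∷ false ∷ false ∷ false ∷ false ∷ []) _ (suc (suc (suc (suc zero))) , ())
K5-dichotomy (true ∷ true ∷ true ∷ true ∷ true ∷ []) (zero , ()) _
K5-dichotomy (true ∷ true ∷ true ∷ true ∷ true ∷ []) (suc zero , ()) _
K5-dichotomy (true ∷ true ∷ true ∷ true ∷ true ∷ []) (suc (suc zero) , ()) _
K5-dichotomy (true ∷ true ∷ true ∷ true ∷ true ∷ []) (suc (suc (suc zero)) , ()) _
K5-dichotomy (true ∷ true ∷ true ∷ true ∷ true ∷ []) (suc (suc (suc (suc zero))) , ()) _
K5-dichotomy (true  ∷ false ∷ false ∷ false ∷ false ∷ []) _ _ = inj₁ (refl , refl)
K5-dichotomy (false ∷ true  ∷ false ∷ false ∷ false ∷ []) _ _ = inj₁ (refl , refl)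
K5-dichotomy (false ∷ false ∷ true  ∷ false ∷ false ∷ []) _ _ = inj₁ (refl , refl)
K5-dichotomy (false ∷ false ∷ false ∷ true  ∷ false ∷ []) _ _ = inj₁ (refl , refl)
K5-dichotomy (false ∷ false ∷ false ∷ false ∷ true  ∷ []) _ _ = inj₁ (refl , refl)
K5-dichotomy (false ∷ false ∷ false ∷ true  ∷ true  ∷ []) _ _ = inj₂ (_ , refl)
K5-dichotomy (false ∷ false ∷ true  ∷ false ∷ true  ∷ []) _ _ = inj₂ (_ , refl)
K5-dichotomy (false ∷ false ∷ true  ∷ true  ∷ false ∷ []) _ _ = inj₂ (_ , refl)
K5-dichotomy (false ∷ false ∷ true  ∷ true  ∷ true  ∷ []) _ _ = inj₂ (_ , refl)
K5-dichotomy (false ∷ true  ∷ false ∷ false ∷ true  ∷ []) _ _ = inj₂ (_ , refl)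
K5-dichotomy (false ∷ true  ∷ false ∷ true  ∷ false ∷ []) _ _ = inj₂ (_ , refl)
K5-dichotomy (false ∷ true  ∷ false ∷ true  ∷ true  ∷ []) _ _ = inj₂ (_ , refl)
K5-dichotomy (false ∷ true  ∷ true  ∷ false ∷ false ∷ []) _ _ = inj₂ (_ , refl)
K5-dichotomy (false ∷ true  ∷ true  ∷ false ∷ true  ∷ []) _ _ = inj₂ (_ , refl)
K5-dichotomy (false ∷ true  ∷ true  ∷ true  ∷ false ∷ []) _ _ = inj₂ (_ , refl)
K5-dichotomy (false ∷ true  ∷ true  ∷ true  ∷ true  ∷ []) _ _ = inj₂ (_ , refl)
K5-dichotomy (true  ∷ false ∷ false ∷ false ∷ true  ∷ []) _ _ = inj₂ (_ , refl)
K5-dichotomy (true  ∷ false ∷ false ∷ true  ∷ false ∷ []) _ _ = inj₂ (_ , refl)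
K5-dichotomy (true  ∷ false ∷ false ∷ true  ∷ true  ∷ []) _ _ = inj₂ (_ , refl)
K5-dichotomy (true  ∷ false ∷ true  ∷ false ∷ false ∷ []) _ _ = inj₂ (_ , refl)
K5-dichotomy (true  ∷ false ∷ true  ∷ false ∷ true  ∷ []) _ _ = inj₂ (_ , refl)
K5-dichotomy (true  ∷ false ∷ true  ∷ true  ∷ false ∷ []) _ _ = inj₂ (_ , refl)
K5-dichotomy (true  ∷ false ∷ true  ∷ true  ∷ true  ∷ []) _ _ = inj₂ (_ , refl)
K5-dichotomy (true  ∷ true  ∷ false ∷ false ∷ false ∷ []) _ _ = inj₂ (_ , refl)
K5-dichotomy (true  ∷ true  ∷ false ∷ false ∷ true  ∷ []) _ _ = inj₂ (_ , refl)
K5-dichotomy (true  ∷ true  ∷ false ∷ true  ∷ false ∷ []) _ _ = inj₂ (_ , refl)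
K5-dichotomy (true  ∷ true  ∷ false ∷ true  ∷ true  ∷ []) _ _ = inj₂ (_ , refl)
K5-dichotomy (true  ∷ true  ∷ true  ∷ false ∷ false ∷ []) _ _ = inj₂ (_ , refl)
K5-dichotomy (true  ∷ true  ∷ true  ∷ false ∷ true  ∷ []) _ _ = inj₂ (_ , refl)
K5-dichotomy (true  ∷ true  ∷ true  ∷ true  ∷ false ∷ []) _ _ = inj₂ (_ , refl)

K5-invariant : (G : Graph 5) → IsK5 G → KYInvariant G
K5-invariant G complete = record
  { uncolourable = uncolourable
  ; pot-whole    = pot-cong {r = λ _ → true} (IsK5⇒K5adj G complete) (λ _ → refl)
  ; pot-proper   = pot-proper
  }
  where
  uncolourable : ∀ (c : Fin 5 → Fin 4) → (∀ u v → Adj G u v → c u ≢ c v) → ⊥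
  uncolourable c proper with pigeonhole (s≤s (s≤s (s≤s (s≤s (s≤s z≤n))))) c
  ... | i , j , i<j , ci≡cj = proper i j (complete i j (<⇒≢ i<j)) ci≡cj
  as-K5 : ∀ r → pot (adj G) r ≡ pot K5adj (lookup (Vec.tabulate r))
  as-K5 r = pot-cong (IsK5⇒K5adj G complete) (sym ∘ lookup∘tabulate r)
  pot-proper : ∀ r → (∃ λ v → r v ≡ false) → (∃ λ v → r v ≡ true) → Dichotomy G r
  pot-proper r (v , rv) (w , rw) with K5-dichotomy (Vec.tabulate r)
                                       (v , trans (lookup∘tabulate r v) rv) (w , trans (lookup∘tabulate r w) rw)
  ... | inj₁ (pot≡9 , size≡1) =
    inj₁ (trans (as-K5 r) pot≡9 , size-one-collapsible G r size-r≡1)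
    where
    size-r≡1 : size r ≡ 1
    size-r≡1 = trans (sum-cong-≗ (cong 𝟙 ∘ sym ∘ lookup∘tabulate r)) size≡1
  ... | inj₂ (d , pot≡) = inj₂ (d , trans (as-K5 r) pot≡)

-- The potential identity of an Ore-composition H of G₁ and G₂ (proved later):
-- PH, P1, P2 are the potentials of a vertex set in H and of its traces in G₁ and
-- G₂, a and b record whether x and y belong to it, and mi counts the edges of G₂
-- at z that are lost in H.
OreIdentity : Bool → Bool → ℕ → ℤ → ℤ → ℤ → Set
OreIdentity a b mi PH P1 P2 =
  PH Z.+ + (9 * 𝟙 (a ∨ b)) ≡ P1 Z.+ P2 Z.+ + (4 * (𝟙 (a ∧ b) + mi))

private
  isolate : ∀ PH c X → PH Z.+ c ≡ X → PH ≡ X Z.- c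
  isolate PH c X eq = trans (lemma PH c) (cong (Z._- c) eq)
    where
    lemma : ∀ (PH c : ℤ) → PH ≡ (PH Z.+ c) Z.- c
    lemma = solve-∀

  4*suc : ∀ k → 4 * suc k ≡ 4 + 4 * k
  4*suc k = *-suc 4 k

-- x, y ∉ R and R avoids G₂ - z: PH = P1.
ff-only-G₁ : ∀ PH P1 → OreIdentity false false 0 PH P1 (+ 0) → PH ≡ P1
ff-only-G₁ PH P1 eq = trans (isolate _ _ _ eq) (lemma P1)
  where
  lemma : ∀ P1 → P1 Z.+ + 0 Z.+ + 0 Z.- + 0 ≡ P1
  lemma = solve-∀

-- x, y ∉ R and R avoids G₁: PH = P2.
ff-only-G₂ : ∀ PH P2 → OreIdentity false false 0 PH (+ 0) P2 → PH ≡ P2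
ff-only-G₂ PH P2 eq = trans (isolate _ _ _ eq) (lemma P2)
  where
  lemma : ∀ P2 → + 0 Z.+ P2 Z.+ + 0 Z.- + 0 ≡ P2
  lemma = solve-∀

-- x, y ∉ R, R meets both sides: PH = P1 + P2 ≥ 18.
ff-both : ∀ PH P1 P2 → OreIdentity false false 0 PH P1 P2 →
          Admissible P1 → Admissible P2 → AtLeast12 PH
ff-both PH _ _ eq (inj₁ refl) (inj₁ refl) = 6 , isolate _ _ _ eq
ff-both PH _ _ eq (inj₁ refl) (inj₂ (d , refl)) = 9 + d , trans (isolate _ _ _ eq) (lemma (+ d))
  where
  lemma : ∀ D → + 9 Z.+ (+ 12 Z.+ D) Z.+ + 0 Z.- + 0 ≡ + 12 Z.+ (+ 9 Z.+ D)
  lemma = solve-∀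
ff-both PH _ _ eq (inj₂ (d , refl)) (inj₁ refl) = 9 + d , trans (isolate _ _ _ eq) (lemma (+ d))
  where
  lemma : ∀ D → (+ 12 Z.+ D) Z.+ + 9 Z.+ + 0 Z.- + 0 ≡ + 12 Z.+ (+ 9 Z.+ D)
  lemma = solve-∀
ff-both PH _ _ eq (inj₂ (d , refl)) (inj₂ (d' , refl)) =
  12 + (d + d') , trans (isolate _ _ _ eq) (lemma (+ d) (+ d'))
  where
  lemma : ∀ D D' → (+ 12 Z.+ D) Z.+ (+ 12 Z.+ D') Z.+ + 0 Z.- + 0 ≡ + 12 Z.+ (+ 12 Z.+ (D Z.+ D'))
  lemma = solve-∀

-- R = V(H): PH = 5 + 5 + 4 - 9 = 5.
tt-whole : ∀ PH → OreIdentity true true 0 PH (+ 5) (+ 5) → PH ≡ + 5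
tt-whole PH eq = isolate _ _ _ eq

-- x, y ∈ R ⊇ V(G₁): PH = P2.
tt-G₁-whole : ∀ PH P2 → OreIdentity true true 0 PH (+ 5) P2 → PH ≡ P2
tt-G₁-whole PH P2 eq = trans (isolate _ _ _ eq) (lemma P2)
  where
  lemma : ∀ P2 → + 5 Z.+ P2 Z.+ + 4 Z.- + 9 ≡ P2
  lemma = solve-∀

-- x, y ∈ R ⊇ V(G₂): PH = P1.
tt-G₂-whole : ∀ PH P1 → OreIdentity true true 0 PH P1 (+ 5) → PH ≡ P1
tt-G₂-whole PH P1 eq = trans (isolate _ _ _ eq) (lemma P1)
  where
  lemma : ∀ P1 → P1 Z.+ + 5 Z.+ + 4 Z.- + 9 ≡ P1
  lemma = solve-∀

-- x, y ∈ R, R proper on both sides: PH = P1 + P2 - 5 ≥ 13.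
tt-both : ∀ PH P1 P2 → OreIdentity true true 0 PH P1 P2 →
          Admissible P1 → Admissible P2 → AtLeast12 PH
tt-both PH _ _ eq (inj₁ refl) (inj₁ refl) = 1 , isolate _ _ _ eq
tt-both PH _ _ eq (inj₁ refl) (inj₂ (d , refl)) = 4 + d , trans (isolate _ _ _ eq) (lemma (+ d))
  where
  lemma : ∀ D → + 9 Z.+ (+ 12 Z.+ D) Z.+ + 4 Z.- + 9 ≡ + 12 Z.+ (+ 4 Z.+ D)
  lemma = solve-∀
tt-both PH _ _ eq (inj₂ (d , refl)) (inj₁ refl) = 4 + d , trans (isolate _ _ _ eq) (lemma (+ d))
  where
  lemma : ∀ D → (+ 12 Z.+ D) Z.+ + 9 Z.+ + 4 Z.- + 9 ≡ + 12 Z.+ (+ 4 Z.+ D)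
  lemma = solve-∀
tt-both PH _ _ eq (inj₂ (d , refl)) (inj₂ (d' , refl)) =
  7 + (d + d') , trans (isolate _ _ _ eq) (lemma (+ d) (+ d'))
  where
  lemma : ∀ D D' → (+ 12 Z.+ D) Z.+ (+ 12 Z.+ D') Z.+ + 4 Z.- + 9 ≡ + 12 Z.+ (+ 7 Z.+ (D Z.+ D'))
  lemma = solve-∀

-- x ∈ R, y ∉ R, R ⊇ V(G₂) - z, and 1 + k edges at z are lost:
-- PH = P1 + 4k, which is 9 only when k = 0 and P1 = 9.
tf-G₂-whole : ∀ PH P1 k → OreIdentity true false (suc k) PH P1 (+ 5) → Admissible P1 →
              (PH ≡ + 9 × k ≡ 0 × P1 ≡ + 9) ⊎ AtLeast12 PH
tf-G₂-whole PH P1 k eq adm =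
  go k (trans (isolate _ _ _ eq) (trans (cong (λ t → P1 Z.+ + 5 Z.+ + t Z.- + 9) (4*suc k)) (lemma P1 (+ (4 * k))))) adm
  where
  lemma : ∀ P1 K → P1 Z.+ + 5 Z.+ (+ 4 Z.+ K) Z.- + 9 ≡ P1 Z.+ K
  lemma = solve-∀
  go : ∀ {P1} k → PH ≡ P1 Z.+ + (4 * k) → Admissible P1 → (PH ≡ + 9 × k ≡ 0 × P1 ≡ + 9) ⊎ AtLeast12 PH
  go zero     eq′ (inj₁ refl) = inj₁ (eq′ , refl , refl)
  go (suc k′) eq′ (inj₁ refl) =
    inj₂ (1 + 4 * k′ , trans eq′ (trans (cong (λ t → + 9 Z.+ + t) (4*suc k′)) (lemma′ (+ (4 * k′)))))
    where
    lemma′ : ∀ K → + 9 Z.+ (+ 4 Z.+ K) ≡ + 12 Z.+ (+ 1 Z.+ K)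
    lemma′ = solve-∀
  go k eq′ (inj₂ (d , refl)) = inj₂ (d + 4 * k , trans eq′ (lemma′ (+ d) (+ (4 * k))))
    where
    lemma′ : ∀ D K → + 12 Z.+ D Z.+ K ≡ + 12 Z.+ (D Z.+ K)
    lemma′ = solve-∀

-- x ∈ R, y ∉ R, R proper on both sides: PH = P1 + P2 - 9 + 4·mi, which is 9
-- only when P1 = P2 = 9 and no edge at z is lost.
tf-both : ∀ PH P1 P2 mi → OreIdentity true false mi PH P1 P2 → Admissible P1 → Admissible P2 →
          (PH ≡ + 9 × P1 ≡ + 9 × P2 ≡ + 9 × mi ≡ 0) ⊎ AtLeast12 PH
tf-both PH P1 P2 mi eq adm₁ adm₂ = go mi adm₁ adm₂ (trans (isolate _ _ _ eq) (lemma P1 P2 (+ (4 * mi))))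
  where
  lemma : ∀ P1 P2 M → P1 Z.+ P2 Z.+ M Z.- + 9 ≡ P1 Z.+ P2 Z.- + 9 Z.+ M
  lemma = solve-∀
  go : ∀ {P1 P2} mi → Admissible P1 → Admissible P2 → PH ≡ P1 Z.+ P2 Z.- + 9 Z.+ + (4 * mi) →
       (PH ≡ + 9 × P1 ≡ + 9 × P2 ≡ + 9 × mi ≡ 0) ⊎ AtLeast12 PH
  go zero    (inj₁ refl) (inj₁ refl) eq′ = inj₁ (eq′ , refl , refl , refl)
  go (suc k) (inj₁ refl) (inj₁ refl) eq′ =
    inj₂ (1 + 4 * k , trans eq′ (trans (cong (λ t → + 9 Z.+ + 9 Z.- + 9 Z.+ + t) (4*suc k)) (lemma′ (+ (4 * k)))))
    where
    lemma′ : ∀ K → + 9 Z.+ + 9 Z.- + 9 Z.+ (+ 4 Z.+ K) ≡ + 12 Z.+ (+ 1 Z.+ K)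
    lemma′ = solve-∀
  go mi (inj₁ refl) (inj₂ (d , refl)) eq′ = inj₂ (d + 4 * mi , trans eq′ (lemma′ (+ d) (+ (4 * mi))))
    where
    lemma′ : ∀ D K → + 9 Z.+ (+ 12 Z.+ D) Z.- + 9 Z.+ K ≡ + 12 Z.+ (D Z.+ K)
    lemma′ = solve-∀
  go mi (inj₂ (d , refl)) (inj₁ refl) eq′ = inj₂ (d + 4 * mi , trans eq′ (lemma′ (+ d) (+ (4 * mi))))
    where
    lemma′ : ∀ D K → (+ 12 Z.+ D) Z.+ + 9 Z.- + 9 Z.+ K ≡ + 12 Z.+ (D Z.+ K)
    lemma′ = solve-∀
  go mi (inj₂ (d , refl)) (inj₂ (d' , refl)) eq′ =
    inj₂ (3 + (d + d') + 4 * mi , trans eq′ (lemma′ (+ d) (+ d') (+ (4 * mi))))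
    where
    lemma′ : ∀ D D' K → (+ 12 Z.+ D) Z.+ (+ 12 Z.+ D') Z.- + 9 Z.+ K ≡ + 12 Z.+ (+ 3 Z.+ (D Z.+ D') Z.+ K)
    lemma′ = solve-∀

∧-true⁻ : ∀ {a b} → a ∧ b ≡ true → a ≡ true × b ≡ true
∧-true⁻ {true} {true} _ = refl , refl

∧-true⁺ : ∀ {a b} → a ≡ true → b ≡ true → a ∧ b ≡ true
∧-true⁺ refl refl = refl

true≢false : ∀ {a} → a ≡ true → a ≡ false → ⊥
true≢false refl ()

no-edge : ∀ s t → 𝟙 (s ∧ t ∧ false) ≡ 0
no-edge s t = cong 𝟙 (trans (cong (_∧_ s) (∧-zeroʳ t)) (∧-zeroʳ s))

punchIn-cover : ∀ {m} (z v : Fin (suc m)) → v ≡ z ⊎ ∃ λ w → punchIn z w ≡ v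
punchIn-cover z v with z ≟ v
... | yes z≡v = inj₁ (sym z≡v)
... | no  z≢v = inj₂ (punchOut z≢v , punchIn-punchOut z≢v)

deletion-split : ∀ s t A P → (P ≡ true → A ≡ true) →
                 𝟙 (s ∧ t ∧ A) ≡ 𝟙 (s ∧ t ∧ (A ∧ not P)) + 𝟙 (s ∧ t ∧ P)
deletion-split false t     A     P     _ = refl
deletion-split true  false A     P     _ = refl
deletion-split true  true  A     false _ rewrite ∧-identityʳ A = sym (+-identityʳ (𝟙 A))
deletion-split true  true  true  true  _ = refl
deletion-split true  true  false true  P⇒A with P⇒A refl
... | ()

-- Splitting the vertex z: a G₂-edge from w to z inside the trace of r is either
-- realised in H as an edge from w to x or to y inside r, or it is lost (the
-- endpoint w is attached to in H is outside r).
Lost : Bool → Bool → Bool → Bool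
Lost s a b = (a ∨ b) ∧ not (if s then a else b)

crossing-split : ∀ ρ a b A s →
  𝟙 (ρ ∧ (a ∨ b) ∧ A) ≡ (𝟙 (ρ ∧ a ∧ (A ∧ s)) + 𝟙 (ρ ∧ b ∧ (A ∧ not s))) + 𝟙 (ρ ∧ A ∧ Lost s a b)
crossing-split false _     _     _     _     = refl
crossing-split true  false false false false = refl
crossing-split true  false false false true  = refl
crossing-split true  false false true  false = refl
crossing-split true  false false true  true  = refl
crossing-split true  false true  false false = refl
crossing-split true  false true  false true  = refl
crossing-split true  false true  true  false = refl
crossing-split true  false true  true  true  = refl
crossing-split true  true  false false false = refl
crossing-split true  true  false false true  = refl
crossing-split true  true  false true  false = refl
crossing-split true  true  false true  true  = refl
crossing-split true  true  true  false false = refl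
crossing-split true  true  true  false true  = refl
crossing-split true  true  true  true  false = refl
crossing-split true  true  true  true  true  = refl

potential-combination : ∀ (s o s₁ s₂ d ab mi d₁ d₂ : ℕ) → s + o ≡ s₁ + s₂ → d + 2 * ab + 2 * mi ≡ d₁ + d₂ →
  (+ (9 * s) Z.- + (2 * d)) Z.+ + (9 * o) ≡
  (+ (9 * s₁) Z.- + (2 * d₁)) Z.+ (+ (9 * s₂) Z.- + (2 * d₂)) Z.+ + (4 * (ab + mi))
potential-combination s o s₁ s₂ d ab mi d₁ d₂ vertices edges = begin
  (+ (9 * s) Z.- + (2 * d)) Z.+ + (9 * o)
    ≡⟨ cong₂ Z._+_ (cong₂ Z._-_ (pos-* 9 s) (pos-* 2 d)) (pos-* 9 o) ⟩
  (+ 9 Z.* S Z.- + 2 Z.* D) Z.+ + 9 Z.* O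
    ≡⟨ regroup S O D AB MI ⟩
  + 9 Z.* (S Z.+ O) Z.- + 2 Z.* (D Z.+ + 2 Z.* AB Z.+ + 2 Z.* MI) Z.+ + 4 Z.* (AB Z.+ MI)
    ≡⟨ cong₂ (λ k l → + 9 Z.* k Z.- + 2 Z.* l Z.+ + 4 Z.* (AB Z.+ MI)) vertices′ edges′ ⟩
  + 9 Z.* (S₁ Z.+ S₂) Z.- + 2 Z.* (D₁ Z.+ D₂) Z.+ + 4 Z.* (AB Z.+ MI)
    ≡⟨ split S₁ S₂ D₁ D₂ AB MI ⟩
  (+ 9 Z.* S₁ Z.- + 2 Z.* D₁) Z.+ (+ 9 Z.* S₂ Z.- + 2 Z.* D₂) Z.+ + 4 Z.* (AB Z.+ MI)
    ≡⟨ cong₂ Z._+_ (cong₂ Z._+_ (cong₂ Z._-_ (pos-* 9 s₁) (pos-* 2 d₁)) (cong₂ Z._-_ (pos-* 9 s₂) (pos-* 2 d₂)))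
                   (trans (pos-* 4 (ab + mi)) (cong (Z._*_ (+ 4)) (pos-+ ab mi))) ⟨
  (+ (9 * s₁) Z.- + (2 * d₁)) Z.+ (+ (9 * s₂) Z.- + (2 * d₂)) Z.+ + (4 * (ab + mi))  ∎
  where
  open ≡-Reasoning
  S O S₁ S₂ D AB MI D₁ D₂ : ℤ
  S  = + s
  O  = + o
  S₁ = + s₁
  S₂ = + s₂
  D  = + d
  AB = + ab
  MI = + mi
  D₁ = + d₁
  D₂ = + d₂
  vertices′ : S Z.+ O ≡ S₁ Z.+ S₂
  vertices′ = trans (sym (pos-+ s o)) (trans (cong +_ vertices) (pos-+ s₁ s₂))
  edges′ : D Z.+ + 2 Z.* AB Z.+ + 2 Z.* MI ≡ D₁ Z.+ D₂
  edges′ = begin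
    D Z.+ + 2 Z.* AB Z.+ + 2 Z.* MI     ≡⟨ cong₂ (λ k l → D Z.+ k Z.+ l) (pos-* 2 ab) (pos-* 2 mi) ⟨
    D Z.+ + (2 * ab) Z.+ + (2 * mi)     ≡⟨ cong (Z._+ + (2 * mi)) (pos-+ d (2 * ab)) ⟨
    + (d + 2 * ab) Z.+ + (2 * mi)       ≡⟨ pos-+ (d + 2 * ab) (2 * mi) ⟨
    + (d + 2 * ab + 2 * mi)             ≡⟨ cong +_ edges ⟩
    + (d₁ + d₂)                         ≡⟨ pos-+ d₁ d₂ ⟩
    D₁ Z.+ D₂                           ∎
  regroup : ∀ S O D AB MI → (+ 9 Z.* S Z.- + 2 Z.* D) Z.+ + 9 Z.* O ≡
            + 9 Z.* (S Z.+ O) Z.- + 2 Z.* (D Z.+ + 2 Z.* AB Z.+ + 2 Z.* MI) Z.+ + 4 Z.* (AB Z.+ MI)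
  regroup = solve-∀
  split : ∀ S₁ S₂ D₁ D₂ AB MI → + 9 Z.* (S₁ Z.+ S₂) Z.- + 2 Z.* (D₁ Z.+ D₂) Z.+ + 4 Z.* (AB Z.+ MI) ≡
          (+ 9 Z.* S₁ Z.- + 2 Z.* D₁) Z.+ (+ 9 Z.* S₂ Z.- + 2 Z.* D₂) Z.+ + 4 Z.* (AB Z.+ MI)
  split = solve-∀

adj-sym : ∀ {n} (G : Graph n) {u v} → Adj G u v → Adj G v u
adj-sym G {u} {v} e = trans (Graph.sym G v u) e

module OreGeometry {n₁ m n} {G₁ : Graph n₁} {G₂ : Graph (suc m)} {H : Graph n}
                   (oc : OreComp G₁ G₂ H) where
  open OreComp oc public

  p : Fin m → Fin (suc m)
  p = punchIn z

  x≢y : x ≢ y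
  x≢y refl = true≢false xy-edge (Graph.irrefl G₁ x)

  Deleted : Fin n₁ → Fin n₁ → Set
  Deleted u u' = (u ≡ x × u' ≡ y) ⊎ (u ≡ y × u' ≡ x)

  deleted? : ∀ u u' → Dec (Deleted u u')
  deleted? u u' = (u ≟ x ×-dec u' ≟ y) ⊎-dec (u ≟ y ×-dec u' ≟ x)

  deleted⇒edge : ∀ u u' → ⌊ deleted? u u' ⌋ ≡ true → adj G₁ u u' ≡ true
  deleted⇒edge u u' _ with deleted? u u'
  deleted⇒edge u u' _  | yes (inj₁ (refl , refl)) = xy-edge
  deleted⇒edge u u' _  | yes (inj₂ (refl , refl)) = trans (Graph.sym G₁ y x) xy-edge
  deleted⇒edge u u' () | no _

  adj-ff-bool : ∀ u u' → adj H (f u) (f u') ≡ adj G₁ u u' ∧ not ⌊ deleted? u u' ⌋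
  adj-ff-bool u u' with deleted? u u'
  ... | yes del rewrite ∧-zeroʳ (adj G₁ u u') =
    ¬-not λ h → proj₂ (Equivalence.to (adj-ff u u') h) del
  ... | no ¬del rewrite ∧-identityʳ (adj G₁ u u') =
    ⇔→≡ (mk⇔ (proj₁ ∘ Equivalence.to (adj-ff u u')) λ h → Equivalence.from (adj-ff u u') (h , ¬del))

  adj-gf-x : ∀ w → adj H (g w) (f x) ≡ adj G₂ (p w) z ∧ side w
  adj-gf-x w = ⇔→≡ (mk⇔ to from)
    where
    to : adj H (g w) (f x) ≡ true → adj G₂ (p w) z ∧ side w ≡ true
    to h with Equivalence.to (adj-gf w x) h
    ... | wz , inj₁ (_ , s) = ∧-true⁺ wz s
    ... | _  , inj₂ (x≡y , _) = ⊥-elim (x≢y x≡y)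
    from : adj G₂ (p w) z ∧ side w ≡ true → adj H (g w) (f x) ≡ true
    from h = Equivalence.from (adj-gf w x) (proj₁ (∧-true⁻ h) , inj₁ (refl , proj₂ (∧-true⁻ h)))

  adj-gf-y : ∀ w → adj H (g w) (f y) ≡ adj G₂ (p w) z ∧ not (side w)
  adj-gf-y w = ⇔→≡ (mk⇔ to from)
    where
    to : adj H (g w) (f y) ≡ true → adj G₂ (p w) z ∧ not (side w) ≡ true
    to h with Equivalence.to (adj-gf w y) h
    ... | wz , inj₂ (_ , s) = ∧-true⁺ wz (cong not s)
    ... | _  , inj₁ (y≡x , _) = ⊥-elim (x≢y (sym y≡x))
    from : adj G₂ (p w) z ∧ not (side w) ≡ true → adj H (g w) (f y) ≡ true
    from h = Equivalence.from (adj-gf w y)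
      (proj₁ (∧-true⁻ h) , inj₂ (refl , trans (sym (not-involutive (side w))) (cong not (proj₂ (∧-true⁻ h)))))

  adj-gf-other : ∀ w u → u ≢ x → u ≢ y → adj H (g w) (f u) ≡ false
  adj-gf-other w u u≢x u≢y = ¬-not λ h → [ (λ e → u≢x (proj₁ e)) , (λ e → u≢y (proj₁ e)) ]′
    (proj₂ (Equivalence.to (adj-gf w u) h))

  sum-H : (φ : Fin n → ℕ) → sum φ ≡ sum (φ ∘ f) + sum (φ ∘ g)
  sum-H = sum-partition f g f-inj g-inj fg-disj fg-cover

  module Trace (r : Fin n → Bool) where
    a b o : Bool
    a = r (f x)
    b = r (f y)
    o = a ∨ b

    r₁ : Fin n₁ → Bool
    r₁ = r ∘ f

    r₀ : Fin m → Bool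
    r₀ = r ∘ g

    r₂ : Fin (suc m) → Bool
    r₂ = insertAt r₀ z o

    r₂-z : r₂ z ≡ o
    r₂-z = insertAt-lookup r₀ z o

    r₂-p : ∀ w → r₂ (p w) ≡ r₀ w
    r₂-p = insertAt-punchIn r₀ z o

    nbz : Fin m → Bool
    nbz w = adj G₂ (p w) z

    -- toX w, toY w: the H-edge from g w to x, resp. y, inside r.
    -- lost w: the G₂-edge wz lies inside r₂ but its image in H leaves r.
    toX toY lost : Fin m → ℕ
    toX w  = 𝟙 (r₀ w ∧ a ∧ (nbz w ∧ side w))
    toY w  = 𝟙 (r₀ w ∧ b ∧ (nbz w ∧ not (side w)))
    lost w = 𝟙 (r₀ w ∧ nbz w ∧ Lost (side w) a b)

    MI : ℕ
    MI = sum lost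

    χ : Fin n → Fin n → ℕ
    χ v v' = 𝟙 (r v ∧ r v' ∧ adj H v v')

    E₁₁ Ecross E₂₂ Ez : ℕ
    E₁₁    = sum λ u → sum λ u' → χ (f u) (f u')
    Ecross = sum λ w → toX w + toY w
    E₂₂    = sum λ w → sum λ w' → 𝟙 (r₀ w ∧ r₀ w' ∧ adj G₂ (p w) (p w'))
    Ez     = sum λ w → 𝟙 (r₀ w ∧ o ∧ nbz w)

    size-identity : size r + 𝟙 o ≡ size r₁ + size r₂
    size-identity = begin
      size r + 𝟙 o                    ≡⟨ cong (_+ 𝟙 o) (sum-H (𝟙 ∘ r)) ⟩
      size r₁ + size r₀ + 𝟙 o         ≡⟨ +-assoc (size r₁) (size r₀) (𝟙 o) ⟩
      size r₁ + (size r₀ + 𝟙 o)       ≡⟨ cong (_+_ (size r₁)) (+-comm (size r₀) (𝟙 o)) ⟩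
      size r₁ + (𝟙 o + size r₀)       ≡⟨ cong (_+_ (size r₁)) size-r₂ ⟨
      size r₁ + size r₂               ∎
      where
      open ≡-Reasoning
      size-r₂ : size r₂ ≡ 𝟙 o + size r₀
      size-r₂ = trans (sum-remove {i = z} (𝟙 ∘ r₂)) (cong₂ _+_ (cong 𝟙 r₂-z) (sum-cong-≗ (cong 𝟙 ∘ r₂-p)))

    crossing-row : ∀ w → sum (λ u → χ (g w) (f u)) ≡ toX w + toY w
    crossing-row w = trans
      (sum-pair (λ u → χ (g w) (f u)) x y x≢y λ u u≢x u≢y →
        trans (cong (λ t → 𝟙 (r₀ w ∧ r (f u) ∧ t)) (adj-gf-other w u u≢x u≢y)) (no-edge (r₀ w) (r (f u))))
      (cong₂ _+_ (cong (λ t → 𝟙 (r₀ w ∧ a ∧ t)) (adj-gf-x w)) (cong (λ t → 𝟙 (r₀ w ∧ b ∧ t)) (adj-gf-y w)))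

    degSum-H : degSum (adj H) r ≡ E₁₁ + Ecross + (Ecross + E₂₂)
    degSum-H = begin
      degSum (adj H) r
        ≡⟨ sum-H (λ v → sum (χ v)) ⟩
      sum (λ u → sum (χ (f u))) + sum (λ w → sum (χ (g w)))
        ≡⟨ cong₂ _+_ (split-rows f) (split-rows g) ⟩
      E₁₁ + FG + (GF + GG)
        ≡⟨ cong₂ (λ k l → E₁₁ + k + l) fg-part (cong₂ _+_ (sum-cong-≗ crossing-row) gg-part) ⟩
      E₁₁ + Ecross + (Ecross + E₂₂)  ∎
      where
      open ≡-Reasoning
      FG GF GG : ℕ
      FG = sum λ u → sum λ w → χ (f u) (g w)
      GF = sum λ w → sum λ u → χ (g w) (f u)
      GG = sum λ w → sum λ w' → χ (g w) (g w')
      split-rows : ∀ {k} (h : Fin k → Fin n) →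
                   sum (λ i → sum (χ (h i))) ≡ sum (λ i → sum (χ (h i) ∘ f)) + sum (λ i → sum (χ (h i) ∘ g))
      split-rows h = trans (sum-cong-≗ λ i → sum-H (χ (h i)))
                           (∑-distrib-+ (λ i → sum (χ (h i) ∘ f)) (λ i → sum (χ (h i) ∘ g)))
      fg-part : FG ≡ Ecross
      fg-part = trans (∑-comm (λ u w → χ (f u) (g w)))
        (sum-cong-≗ λ w → trans (sum-cong-≗ λ u → cong 𝟙 (edge-sym H r (f u) (g w))) (crossing-row w))
      gg-part : GG ≡ E₂₂
      gg-part = sum-cong-≗ λ w → sum-cong-≗ λ w' → cong (λ t → 𝟙 (r₀ w ∧ r₀ w' ∧ t)) (adj-gg w w')

    δ : Fin n₁ → Fin n₁ → ℕ
    δ u u' = 𝟙 (r₁ u ∧ r₁ u' ∧ ⌊ deleted? u u' ⌋)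

    deleted-count : sum (λ u → sum (δ u)) ≡ 2 * 𝟙 (a ∧ b)
    deleted-count = begin
      sum (λ u → sum (δ u))
        ≡⟨ sum-pair _ x y x≢y (λ u u≢x u≢y → sum-zero _ λ u' → off u u' (neither u≢x u≢y)) ⟩
      sum (δ x) + sum (δ y)
        ≡⟨ cong₂ _+_ (sum-single _ y λ u' → off x u' ∘ from-x) (sum-single _ x λ u' → off y u' ∘ from-y) ⟩
      δ x y + δ y x
        ≡⟨ cong₂ _+_ (on x y (inj₁ (refl , refl))) (on y x (inj₂ (refl , refl))) ⟩
      𝟙 (a ∧ b ∧ true) + 𝟙 (b ∧ a ∧ true)
        ≡⟨ both a b ⟩
      2 * 𝟙 (a ∧ b)  ∎
      where
      open ≡-Reasoning
      off : ∀ u u' → ¬ Deleted u u' → δ u u' ≡ 0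
      off u u' ¬del = trans (cong (λ t → 𝟙 (r₁ u ∧ r₁ u' ∧ t)) (⌊⌋-false (deleted? u u') ¬del)) (no-edge (r₁ u) (r₁ u'))
      on : ∀ u u' → Deleted u u' → δ u u' ≡ 𝟙 (r₁ u ∧ r₁ u' ∧ true)
      on u u' del = cong (λ t → 𝟙 (r₁ u ∧ r₁ u' ∧ t)) (⌊⌋-true (deleted? u u') del)
      neither : ∀ {u u'} → u ≢ x → u ≢ y → ¬ Deleted u u'
      neither u≢x _   (inj₁ (e , _)) = u≢x e
      neither _   u≢y (inj₂ (e , _)) = u≢y e
      from-x : ∀ {u'} → u' ≢ y → ¬ Deleted x u'
      from-x u'≢y (inj₁ (_ , e)) = u'≢y e
      from-x _    (inj₂ (e , _)) = x≢y e
      from-y : ∀ {u'} → u' ≢ x → ¬ Deleted y u'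
      from-y _    (inj₁ (e , _)) = x≢y (sym e)
      from-y u'≢x (inj₂ (_ , e)) = u'≢x e
      both : ∀ a b → 𝟙 (a ∧ b ∧ true) + 𝟙 (b ∧ a ∧ true) ≡ 2 * 𝟙 (a ∧ b)
      both true  true  = refl
      both true  false = refl
      both false true  = refl
      both false false = refl

    degSum-G₁ : degSum (adj G₁) r₁ ≡ E₁₁ + 2 * 𝟙 (a ∧ b)
    degSum-G₁ = begin
      degSum (adj G₁) r₁
        ≡⟨ sum-cong-≗ (λ u → trans (sum-cong-≗ λ u' → split u u') (∑-distrib-+ (χ (f u) ∘ f) (δ u))) ⟩
      sum (λ u → sum (χ (f u) ∘ f) + sum (δ u))
        ≡⟨ ∑-distrib-+ (λ u → sum (χ (f u) ∘ f)) (λ u → sum (δ u)) ⟩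
      E₁₁ + sum (λ u → sum (δ u))
        ≡⟨ cong (_+_ E₁₁) deleted-count ⟩
      E₁₁ + 2 * 𝟙 (a ∧ b)  ∎
      where
      open ≡-Reasoning
      split : ∀ u u' → 𝟙 (r₁ u ∧ r₁ u' ∧ adj G₁ u u') ≡ χ (f u) (f u') + δ u u'
      split u u' = trans (deletion-split (r₁ u) (r₁ u') (adj G₁ u u') _ (deleted⇒edge u u'))
        (cong (λ t → 𝟙 (r₁ u ∧ r₁ u' ∧ t) + δ u u') (sym (adj-ff-bool u u')))

    degSum-G₂ : degSum (adj G₂) r₂ ≡ Ez + (Ez + E₂₂)
    degSum-G₂ = begin
      degSum (adj G₂) r₂
        ≡⟨ sum-remove {i = z} (λ v → sum (χ₂ v)) ⟩
      sum (χ₂ z) + sum (λ w → sum (χ₂ (p w)))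
        ≡⟨ cong₂ _+_ z-row (sum-cong-≗ λ w → sum-remove {i = z} (χ₂ (p w))) ⟩
      Ez + sum (λ w → χ₂ (p w) z + sum (λ w' → χ₂ (p w) (p w')))
        ≡⟨ cong (_+_ Ez) (∑-distrib-+ (λ w → χ₂ (p w) z) (λ w → sum (λ w' → χ₂ (p w) (p w')))) ⟩
      Ez + (sum (λ w → χ₂ (p w) z) + sum (λ w → sum (λ w' → χ₂ (p w) (p w'))))
        ≡⟨ cong (_+_ Ez) (cong₂ _+_ (sum-cong-≗ p-z) (sum-cong-≗ λ w → sum-cong-≗ (p-p w))) ⟩
      Ez + (Ez + E₂₂)  ∎
      where
      open ≡-Reasoning
      χ₂ : Fin (suc m) → Fin (suc m) → ℕ
      χ₂ v v' = 𝟙 (r₂ v ∧ r₂ v' ∧ adj G₂ v v')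
      p-z : ∀ w → χ₂ (p w) z ≡ 𝟙 (r₀ w ∧ o ∧ nbz w)
      p-z w = cong₂ (λ k l → 𝟙 (k ∧ l ∧ nbz w)) (r₂-p w) r₂-z
      p-p : ∀ w w' → χ₂ (p w) (p w') ≡ 𝟙 (r₀ w ∧ r₀ w' ∧ adj G₂ (p w) (p w'))
      p-p w w' = cong₂ (λ k l → 𝟙 (k ∧ l ∧ adj G₂ (p w) (p w'))) (r₂-p w) (r₂-p w')
      z-row : sum (χ₂ z) ≡ Ez
      z-row = begin
        sum (χ₂ z)
          ≡⟨ sum-remove {i = z} (χ₂ z) ⟩
        χ₂ z z + sum (λ w → χ₂ z (p w))
          ≡⟨ cong₂ _+_ no-loop (sum-cong-≗ λ w → trans (cong 𝟙 (edge-sym G₂ r₂ z (p w))) (p-z w)) ⟩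
        0 + Ez  ∎
        where
        no-loop : χ₂ z z ≡ 0
        no-loop = trans (cong (λ t → 𝟙 (r₂ z ∧ r₂ z ∧ t)) (Graph.irrefl G₂ z)) (no-edge (r₂ z) (r₂ z))

    Ez-split : Ez ≡ Ecross + MI
    Ez-split = trans (sum-cong-≗ λ w → crossing-split (r₀ w) a b (nbz w) (side w))
                     (∑-distrib-+ (λ w → toX w + toY w) lost)

    degSum-identity : degSum (adj H) r + 2 * 𝟙 (a ∧ b) + 2 * MI ≡ degSum (adj G₁) r₁ + degSum (adj G₂) r₂
    degSum-identity rewrite degSum-H | degSum-G₁ | degSum-G₂ | Ez-split = regroup E₁₁ Ecross E₂₂ (𝟙 (a ∧ b)) MI
      where
      regroup : ∀ E₁₁ C E₂₂ ab mi → E₁₁ + C + (C + E₂₂) + 2 * ab + 2 * mi ≡ (E₁₁ + 2 * ab) + ((C + mi) + ((C + mi) + E₂₂))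
      regroup = ℕ-Ring.solve-∀

    potential-identity : OreIdentity a b MI (pot (adj H) r) (pot (adj G₁) r₁) (pot (adj G₂) r₂)
    potential-identity = potential-combination (size r) (𝟙 o) (size r₁) (size r₂) (degSum (adj H) r)
      (𝟙 (a ∧ b)) MI (degSum (adj G₁) r₁) (degSum (adj G₂) r₂) size-identity degSum-identity

OreComp-swap : ∀ {n₁ m n} {G₁ : Graph n₁} {G₂ : Graph (suc m)} {H : Graph n} →
               OreComp G₁ G₂ H → OreComp G₁ G₂ H
OreComp-swap {G₁ = G₁} oc = record
  { x = y ; y = x ; xy-edge = trans (Graph.sym G₁ y x) xy-edge ; z = z ; side = not ∘ side
  ; f = f ; g = g ; f-inj = f-inj ; g-inj = g-inj ; fg-disj = fg-disj ; fg-cover = fg-cover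
  ; adj-ff = λ u u' → mk⇔ (λ h → let (e , ¬del) = Equivalence.to (adj-ff u u') h in e , ¬del ∘ flip)
                           (λ { (e , ¬del) → Equivalence.from (adj-ff u u') (e , ¬del ∘ flip) })
  ; adj-gg = adj-gg
  ; adj-gf = λ w u → mk⇔ (λ h → let (e , at) = Equivalence.to (adj-gf w u) h in e , attach (side w) at)
                           (λ { (e , at) → Equivalence.from (adj-gf w u) (e , detach (side w) at) })
  ; z₁-pos = let (w , e , s) = z₂-pos in w , e , cong not s
  ; z₂-pos = let (w , e , s) = z₁-pos in w , e , cong not s
  }
  where
  open OreComp oc
  flip : ∀ {A B C D : Set} → (A × B) ⊎ (C × D) → (C × D) ⊎ (A × B)
  flip (inj₁ q) = inj₂ q
  flip (inj₂ q) = inj₁ q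
  attach : ∀ {u} s → (u ≡ x × s ≡ true) ⊎ (u ≡ y × s ≡ false) → (u ≡ y × not s ≡ true) ⊎ (u ≡ x × not s ≡ false)
  attach _ (inj₁ (e , s)) = inj₂ (e , cong not s)
  attach _ (inj₂ (e , s)) = inj₁ (e , cong not s)
  detach : ∀ {u} s → (u ≡ y × not s ≡ true) ⊎ (u ≡ x × not s ≡ false) → (u ≡ x × s ≡ true) ⊎ (u ≡ y × s ≡ false)
  detach true  (inj₂ (e , _)) = inj₁ (e , refl)
  detach false (inj₁ (e , _)) = inj₂ (e , refl)

module OreStep {n₁ m n} {G₁ : Graph n₁} {G₂ : Graph (suc m)} {H : Graph n}
               (I₁ : KYInvariant G₁) (I₂ : KYInvariant G₂) (oc : OreComp G₁ G₂ H) where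
  open OreGeometry oc

  ff-edge : ∀ {u u'} → Adj H (f u) (f u') → Adj G₁ u u'
  ff-edge {u} {u'} e = proj₁ (Equivalence.to (adj-ff u u') e)

  gg-edge⁻ : ∀ {w w'} → Adj H (g w) (g w') → Adj G₂ (p w) (p w')
  gg-edge⁻ {w} {w'} e = trans (sym (adj-gg w w')) e

  gg-edge⁺ : ∀ {w w'} → Adj G₂ (p w) (p w') → Adj H (g w) (g w')
  gg-edge⁺ {w} {w'} e = trans (adj-gg w w') e

  fg-edge-end : ∀ {u w} → Adj H (f u) (g w) → u ≡ x ⊎ u ≡ y
  fg-edge-end {u} {w} e with Equivalence.to (adj-gf w u) (adj-sym H e)
  ... | _ , inj₁ (u≡x , _) = inj₁ u≡x
  ... | _ , inj₂ (u≡y , _) = inj₂ u≡y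

  fg-edge-nbz : ∀ {u w} → Adj H (f u) (g w) → Adj G₂ (p w) z
  fg-edge-nbz {u} {w} e = proj₁ (Equivalence.to (adj-gf w u) (adj-sym H e))

  fg-edge-y-side : ∀ {w} → Adj H (f y) (g w) → side w ≡ false
  fg-edge-y-side {w} e with Equivalence.to (adj-gf w y) (adj-sym H e)
  ... | _ , inj₁ (y≡x , _) = ⊥-elim (x≢y (sym y≡x))
  ... | _ , inj₂ (_ , s)   = s

  edge-to-x : ∀ {w} → Adj G₂ (p w) z → side w ≡ true → Adj H (g w) (f x)
  edge-to-x {w} e s = Equivalence.from (adj-gf w x) (e , inj₁ (refl , s))

  edge-to-y : ∀ {w} → Adj G₂ (p w) z → side w ≡ false → Adj H (g w) (f y)
  edge-to-y {w} e s = Equivalence.from (adj-gf w y) (e , inj₂ (refl , s))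

  module Cases (r : Fin n → Bool) where
    open Trace r public

    identity-at : ∀ {a′ b′ mi P₁ P₂} → a ≡ a′ → b ≡ b′ → MI ≡ mi →
                  pot (adj G₁) r₁ ≡ P₁ → pot (adj G₂) r₂ ≡ P₂ → OreIdentity a′ b′ mi (pot (adj H) r) P₁ P₂
    identity-at refl refl refl refl refl = potential-identity

    inherit : ∀ {k} (G : Graph k) (s : Fin k → Bool) → pot (adj H) r ≡ pot (adj G) s →
              (CollapsibleOn G s → CollapsibleOn H r) → Dichotomy G s → Dichotomy H r
    inherit _ _ same-pot lift (inj₁ (pot≡9 , collapsible)) = inj₁ (trans same-pot pot≡9 , lift collapsible)
    inherit _ _ same-pot lift (inj₂ (d , pot≡))             = inj₂ (d , trans same-pot pot≡)

    o-true : a ≡ true → o ≡ true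
    o-true a≡true = cong (_∨ b) a≡true

    r₂-full : o ≡ true → (∀ w → r₀ w ≡ true) → ∀ v → r₂ v ≡ true
    r₂-full o≡true full v with punchIn-cover z v
    ... | inj₁ refl       = trans r₂-z o≡true
    ... | inj₂ (w , refl) = trans (r₂-p w) (full w)

    r₂-empty : o ≡ false → (∀ w → r₀ w ≡ false) → ∀ v → r₂ v ≡ false
    r₂-empty o≡false empty v with punchIn-cover z v
    ... | inj₁ refl       = trans r₂-z o≡false
    ... | inj₂ (w , refl) = trans (r₂-p w) (empty w)

    r-not-full : (∀ u → r₁ u ≡ true) → (∀ w → r₀ w ≡ true) → ¬ (∃ λ v → r v ≡ false)
    r-not-full full₁ full₀ (v , rv) with fg-cover v
    ... | inj₁ (u , refl) = true≢false (full₁ u) rv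
    ... | inj₂ (w , refl) = true≢false (full₀ w) rv

    restrict-G₁ : ∀ c → ProperOn H r c → (a ≡ true → b ≡ true → c (f x) ≢ c (f y)) → ProperOn G₁ r₁ (c ∘ f)
    restrict-G₁ c proper xy-apart u u' ru ru' e with deleted? u u'
    ... | no ¬del = proper (f u) (f u') ru ru' (Equivalence.from (adj-ff u u') (e , ¬del))
    ... | yes (inj₁ (refl , refl)) = xy-apart ru ru'
    ... | yes (inj₂ (refl , refl)) = xy-apart ru' ru ∘ sym

    restrict-G₂ : ∀ c κ → ProperOn H r c → (∀ w → r₀ w ≡ true → o ≡ true → Adj G₂ (p w) z → c (g w) ≢ κ) →
                  ProperOn G₂ r₂ (insertAt (c ∘ g) z κ)
    restrict-G₂ c κ proper z-ok v v′ rv rv′ e with punchIn-cover z v | punchIn-cover z v′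
    ... | inj₁ refl | inj₁ refl = λ _ → true≢false e (Graph.irrefl G₂ z)
    ... | inj₁ refl | inj₂ (w′ , refl) = λ eq → z-ok w′ (trans (sym (r₂-p w′)) rv′) (trans (sym r₂-z) rv) (adj-sym G₂ e)
      (trans (sym (insertAt-punchIn (c ∘ g) z κ w′)) (trans (sym eq) (insertAt-lookup (c ∘ g) z κ)))
    ... | inj₂ (w , refl) | inj₁ refl = λ eq → z-ok w (trans (sym (r₂-p w)) rv) (trans (sym r₂-z) rv′) e
      (trans (sym (insertAt-punchIn (c ∘ g) z κ w)) (trans eq (insertAt-lookup (c ∘ g) z κ)))
    ... | inj₂ (w , refl) | inj₂ (w′ , refl) = λ eq → proper (g w) (g w′) (trans (sym (r₂-p w)) rv) (trans (sym (r₂-p w′)) rv′)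
      (gg-edge⁺ e) (trans (sym (insertAt-punchIn (c ∘ g) z κ w)) (trans eq (insertAt-punchIn (c ∘ g) z κ w′)))

    -- If r ⊇ V(G₁), every proper colouring of H[r] gives x and y the same colour
    -- (otherwise G₁ would be 4-coloured).
    xy-same : (∀ u → r₁ u ≡ true) → ∀ c → ProperOn H r c → c (f x) ≡ c (f y)
    xy-same full₁ c proper with c (f x) ≟ c (f y)
    ... | yes same = same
    ... | no  apart = ⊥-elim (KYInvariant.uncolourable I₁ (c ∘ f)
      λ u v e → restrict-G₁ c proper (λ _ _ → apart) u v (full₁ u) (full₁ v) e)

    -- If r ⊇ V(G₂) - z and x, y ∈ r, they get different colours (otherwise G₂
    -- would be 4-coloured, giving z the colour of x and y).
    z-takes-xy-colour : a ≡ true → b ≡ true → ∀ c → ProperOn H r c → c (f x) ≡ c (f y) →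
                        ∀ w → r₀ w ≡ true → o ≡ true → Adj G₂ (p w) z → c (g w) ≢ c (f x)
    z-takes-xy-colour a≡true b≡true c proper same w rw _ e with side w in s
    ... | true  = proper (g w) (f x) rw a≡true (edge-to-x e s)
    ... | false = λ eq → proper (g w) (f y) rw b≡true (edge-to-y e s) (trans eq same)

    xy-differ : (∀ w → r₀ w ≡ true) → a ≡ true → b ≡ true → ∀ c → ProperOn H r c → c (f x) ≢ c (f y)
    xy-differ full₀ a≡true b≡true c proper same = KYInvariant.uncolourable I₂ (insertAt (c ∘ g) z (c (f x)))
      λ u v e → restrict-G₂ c (c (f x)) proper (z-takes-xy-colour a≡true b≡true c proper same) u v (full u) (full v) e
      where
      full : ∀ v → r₂ v ≡ true
      full = r₂-full (o-true a≡true) full₀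

    exit-f : ∀ {u} → InBd H r (f u) →
             (∃ λ u′ → r₁ u′ ≡ false × Adj H (f u) (f u′)) ⊎ (∃ λ w → r₀ w ≡ false × Adj H (f u) (g w))
    exit-f (_ , t , rt , e) with fg-cover t
    ... | inj₁ (u′ , refl) = inj₁ (u′ , rt , e)
    ... | inj₂ (w , refl)  = inj₂ (w , rt , e)

    exit-g : ∀ {w} → InBd H r (g w) →
             (∃ λ u′ → r₁ u′ ≡ false × Adj H (g w) (f u′)) ⊎ (∃ λ w′ → r₀ w′ ≡ false × Adj H (g w) (g w′))
    exit-g (_ , t , rt , e) with fg-cover t
    ... | inj₁ (u′ , refl) = inj₁ (u′ , rt , e)
    ... | inj₂ (w′ , refl) = inj₂ (w′ , rt , e)

    single-colour : (κ : (Fin n → Fin 4) → Fin 4) →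
                    (∀ c → ProperOn H r c → ∀ v → InBd H r v → c v ≡ κ c) → CollapsibleOn H r
    single-colour κ all-κ c proper u v bu bv = trans (all-κ c proper u bu) (sym (all-κ c proper v bv))

    via-G₁ : (∀ c → ProperOn H r c → ProperOn G₁ r₁ (c ∘ f)) →
             (∀ v → InBd H r v → ∃ λ u → f u ≡ v × InBd G₁ r₁ u) → CollapsibleOn G₁ r₁ → CollapsibleOn H r
    via-G₁ restrict boundary collapsible₁ c proper v v′ bv bv′ with boundary v bv | boundary v′ bv′
    ... | u , refl , bu | u′ , refl , bu′ = collapsible₁ (c ∘ f) (restrict c proper) u u′ bu bu′

    via-G₂ : (κ : (Fin n → Fin 4) → Fin 4) → (∀ c → ProperOn H r c → ProperOn G₂ r₂ (insertAt (c ∘ g) z (κ c))) →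
             (∀ c → ProperOn H r c → ∀ v → InBd H r v → ∃ λ t → InBd G₂ r₂ t × c v ≡ insertAt (c ∘ g) z (κ c) t) →
             CollapsibleOn G₂ r₂ → CollapsibleOn H r
    via-G₂ κ restrict boundary collapsible₂ c proper v v′ bv bv′ with boundary c proper v bv | boundary c proper v′ bv′
    ... | t , bt , cv≡ | t′ , bt′ , cv′≡ = trans cv≡ (trans (collapsible₂ _ (restrict c proper) t t′ bt bt′) (sym cv′≡))

    MI≡0-both-in : a ≡ true → b ≡ true → MI ≡ 0
    MI≡0-both-in a≡true b≡true = sum-zero lost λ w →
      trans (cong (λ t → 𝟙 (r₀ w ∧ nbz w ∧ t)) (both-in (side w) a≡true b≡true)) (no-edge (r₀ w) (nbz w))
      where
      both-in : ∀ s {a b} → a ≡ true → b ≡ true → Lost s a b ≡ false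
      both-in true  refl refl = refl
      both-in false refl refl = refl

    MI≡0-both-out : a ≡ false → b ≡ false → MI ≡ 0
    MI≡0-both-out a≡false b≡false = sum-zero lost λ w →
      trans (cong₂ (λ k l → 𝟙 (r₀ w ∧ nbz w ∧ Lost (side w) k l)) a≡false b≡false) (no-edge (r₀ w) (nbz w))

    lost-y-side : ∀ {w} → a ≡ true → b ≡ false → r₀ w ≡ true → Adj G₂ (p w) z → side w ≡ false → lost w ≡ 1
    lost-y-side a≡true b≡false rw e s rewrite a≡true | b≡false | rw | e | s = refl

    no-loss⇒x-side : ∀ {w} → a ≡ true → b ≡ false → MI ≡ 0 → r₀ w ≡ true → Adj G₂ (p w) z → side w ≡ true
    no-loss⇒x-side {w} a≡true b≡false MI≡0 rw e with side w in s
    ... | true  = refl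
    ... | false = ⊥-elim (1≢0 (trans (sym (lost-y-side a≡true b≡false rw e s)) (sum≡0⇒term≡0 lost MI≡0 w)))

    some-loss : a ≡ true → b ≡ false → (∀ w → r₀ w ≡ true) → ∃ λ k → MI ≡ suc k
    some-loss a≡true b≡false full₀ with MI in MI≡ | z₂-pos
    ... | zero  | w , e , s = ⊥-elim (1≢0 (trans (sym (lost-y-side a≡true b≡false (full₀ w) e s)) (sum≡0⇒term≡0 lost MI≡ w)))
    ... | suc k | _ = k , refl

    at-most-one-loss : a ≡ true → b ≡ false → MI ≡ 1 → ∀ {w w′} → w ≢ w′ → lost w ≡ 1 → lost w′ ≡ 1 → ⊥
    at-most-one-loss _ _ MI≡1 {w} {w′} w≢w′ lw lw′
      with subst (λ t → lost w + lost w′ ≤ t) MI≡1 (two-terms≤sum lost w w′ w≢w′)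
    ... | le rewrite lw | lw′ with le
    ...   | s≤s ()

    f-exit-in-G₁ : ∀ {u u′} → r₁ u ≡ true → r₁ u′ ≡ false → Adj H (f u) (f u′) → InBd G₁ r₁ u
    f-exit-in-G₁ ru ru′ e = ru , _ , ru′ , ff-edge e

    g-exit-in-G₂ : ∀ {w w′} → r₀ w ≡ true → r₀ w′ ≡ false → Adj H (g w) (g w′) → InBd G₂ r₂ (p w)
    g-exit-in-G₂ {w} {w′} rw rw′ e = trans (r₂-p w) rw , p w′ , trans (r₂-p w′) rw′ , gg-edge⁻ e

    member-in-G₁ : (∀ w → r₀ w ≡ false) → (∃ λ v → r v ≡ true) → ∃ λ u → r₁ u ≡ true
    member-in-G₁ empty₀ (v , rv) with fg-cover v
    ... | inj₁ (u , refl) = u , rv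
    ... | inj₂ (w , refl) = ⊥-elim (true≢false rv (empty₀ w))

    -- Case x, y ∉ r.  Here z ∉ r₂, no edge is lost, and p(r) = p(r₁) + p(r₂).
    module BothOut (a≡false : a ≡ false) (b≡false : b ≡ false) where
      o≡false : o ≡ false
      o≡false = cong₂ _∨_ a≡false b≡false

      identity : OreIdentity false false 0 (pot (adj H) r) (pot (adj G₁) r₁) (pot (adj G₂) r₂)
      identity = identity-at a≡false b≡false (MI≡0-both-out a≡false b≡false) refl refl

      inside-G₁ : (∀ w → r₀ w ≡ false) → (∃ λ u → r₁ u ≡ true) → Dichotomy H r
      inside-G₁ empty₀ member₁ =
        inherit G₁ r₁ same-pot (via-G₁ restrict boundary) (KYInvariant.pot-proper I₁ r₁ (x , a≡false) member₁)
        where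
        same-pot : pot (adj H) r ≡ pot (adj G₁) r₁
        same-pot = ff-only-G₁ _ _ (identity-at a≡false b≡false (MI≡0-both-out a≡false b≡false) refl
                     (pot-empty (adj G₂) r₂ (r₂-empty o≡false empty₀)))
        restrict : ∀ c → ProperOn H r c → ProperOn G₁ r₁ (c ∘ f)
        restrict c proper = restrict-G₁ c proper λ a≡true → ⊥-elim (true≢false a≡true a≡false)
        boundary : ∀ v → InBd H r v → ∃ λ u → f u ≡ v × InBd G₁ r₁ u
        boundary v bv with fg-cover v
        ... | inj₂ (w , refl) = ⊥-elim (true≢false (proj₁ bv) (empty₀ w))
        ... | inj₁ (u , refl) with exit-f bv
        ...   | inj₁ (u′ , ru′ , e) = u , refl , f-exit-in-G₁ (proj₁ bv) ru′ e
        ...   | inj₂ (_ , _ , e) with fg-edge-end e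
        ...     | inj₁ refl = ⊥-elim (true≢false (proj₁ bv) a≡false)
        ...     | inj₂ refl = ⊥-elim (true≢false (proj₁ bv) b≡false)

      -- r inside G₂ - z: r behaves exactly as r₂ (z ∉ r₂, so its colour is irrelevant).
      inside-G₂ : (∀ u → r₁ u ≡ false) → (∃ λ w → r₀ w ≡ true) → Dichotomy H r
      inside-G₂ empty₁ (w₀ , rw₀) =
        inherit G₂ r₂ same-pot (via-G₂ (λ _ → zero) restrict boundary)
          (KYInvariant.pot-proper I₂ r₂ (z , trans r₂-z o≡false) (p w₀ , trans (r₂-p w₀) rw₀))
        where
        same-pot : pot (adj H) r ≡ pot (adj G₂) r₂
        same-pot = ff-only-G₂ _ _ (identity-at a≡false b≡false (MI≡0-both-out a≡false b≡false)
                     (pot-empty (adj G₁) r₁ empty₁) refl)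
        restrict : ∀ c → ProperOn H r c → ProperOn G₂ r₂ (insertAt (c ∘ g) z zero)
        restrict c proper = restrict-G₂ c zero proper λ _ _ o≡true _ → ⊥-elim (true≢false o≡true o≡false)
        boundary : ∀ c → ProperOn H r c → ∀ v → InBd H r v → ∃ λ t → InBd G₂ r₂ t × c v ≡ insertAt (c ∘ g) z zero t
        boundary c _ v bv with fg-cover v
        ... | inj₁ (u , refl) = ⊥-elim (true≢false (proj₁ bv) (empty₁ u))
        ... | inj₂ (w , refl) = p w , bd , sym (insertAt-punchIn (c ∘ g) z zero w)
          where
          bd : InBd G₂ r₂ (p w)
          bd with exit-g bv
          ... | inj₁ (_ , _ , e)    = trans (r₂-p w) (proj₁ bv) , z , trans r₂-z o≡false , fg-edge-nbz (adj-sym H e)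
          ... | inj₂ (_ , rw′ , e)  = g-exit-in-G₂ (proj₁ bv) rw′ e

      meets-both : (∃ λ u → r₁ u ≡ true) → (∃ λ w → r₀ w ≡ true) → Dichotomy H r
      meets-both member₁ (w₀ , rw₀) = inj₂ (ff-both _ _ _ identity
        (dichotomy⇒admissible G₁ r₁ (KYInvariant.pot-proper I₁ r₁ (x , a≡false) member₁))
        (dichotomy⇒admissible G₂ r₂ (KYInvariant.pot-proper I₂ r₂ (z , trans r₂-z o≡false) (p w₀ , trans (r₂-p w₀) rw₀))))

      dichotomy : (∃ λ v → r v ≡ true) → Dichotomy H r
      dichotomy member with empty-or-member r₀ | empty-or-member r₁
      ... | inj₁ empty₀  | _              = inside-G₁ empty₀ (member-in-G₁ empty₀ member)
      ... | inj₂ member₀ | inj₁ empty₁    = inside-G₂ empty₁ member₀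
      ... | inj₂ member₀ | inj₂ member₁   = meets-both member₁ member₀

    -- Case x, y ∈ r.  Here z ∈ r₂ and no edge is lost.
    module BothIn (a≡true : a ≡ true) (b≡true : b ≡ true) where
      z∈r₂ : r₂ z ≡ true
      z∈r₂ = trans r₂-z (o-true a≡true)

      MI≡0 : MI ≡ 0
      MI≡0 = MI≡0-both-in a≡true b≡true

      -- r ⊇ V(G₁), r ⊉ V(G₂) - z: r behaves as r₂, z taking the common colour of
      -- x and y.
      G₁-whole : (∀ u → r₁ u ≡ true) → (∃ λ w → r₀ w ≡ false) → Dichotomy H r
      G₁-whole full₁ (w₁ , rw₁) =
        inherit G₂ r₂ same-pot (via-G₂ (λ c → c (f x)) restrict boundary)
          (KYInvariant.pot-proper I₂ r₂ (p w₁ , trans (r₂-p w₁) rw₁) (z , z∈r₂))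
        where
        same-pot : pot (adj H) r ≡ pot (adj G₂) r₂
        same-pot = tt-G₁-whole _ _ (identity-at a≡true b≡true MI≡0 (pot-full I₁ r₁ full₁) refl)
        restrict : ∀ c → ProperOn H r c → ProperOn G₂ r₂ (insertAt (c ∘ g) z (c (f x)))
        restrict c proper = restrict-G₂ c (c (f x)) proper
          (z-takes-xy-colour a≡true b≡true c proper (xy-same full₁ c proper))
        boundary : ∀ c → ProperOn H r c → ∀ v → InBd H r v →
                   ∃ λ t → InBd G₂ r₂ t × c v ≡ insertAt (c ∘ g) z (c (f x)) t
        boundary c proper v bv with fg-cover v
        ... | inj₁ (u , refl) with exit-f bv
        ...   | inj₁ (u′ , ru′ , _) = ⊥-elim (true≢false (full₁ u′) ru′)
        ...   | inj₂ (w , rw , e) =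
          z , (z∈r₂ , p w , trans (r₂-p w) rw , adj-sym G₂ (fg-edge-nbz e)) ,
          trans (xy-colour (fg-edge-end e)) (sym (insertAt-lookup (c ∘ g) z (c (f x))))
          where
          xy-colour : u ≡ x ⊎ u ≡ y → c (f u) ≡ c (f x)
          xy-colour (inj₁ refl) = refl
          xy-colour (inj₂ refl) = sym (xy-same full₁ c proper)
        boundary c proper v bv | inj₂ (w , refl) with exit-g bv
        ...   | inj₁ (u′ , ru′ , _) = ⊥-elim (true≢false (full₁ u′) ru′)
        ...   | inj₂ (w′ , rw′ , e) =
          p w , g-exit-in-G₂ (proj₁ bv) rw′ e , sym (insertAt-punchIn (c ∘ g) z (c (f x)) w)

      -- r ⊇ V(G₂) - z: r behaves as r₁, x and y being coloured apart.
      G₂-whole : (∀ w → r₀ w ≡ true) → (∃ λ u → r₁ u ≡ false) → Dichotomy H r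
      G₂-whole full₀ nonmember₁ =
        inherit G₁ r₁ same-pot (via-G₁ restrict boundary) (KYInvariant.pot-proper I₁ r₁ nonmember₁ (x , a≡true))
        where
        same-pot : pot (adj H) r ≡ pot (adj G₁) r₁
        same-pot = tt-G₂-whole _ _ (identity-at a≡true b≡true MI≡0 refl
                     (pot-full I₂ r₂ (r₂-full (o-true a≡true) full₀)))
        restrict : ∀ c → ProperOn H r c → ProperOn G₁ r₁ (c ∘ f)
        restrict c proper = restrict-G₁ c proper λ _ _ → xy-differ full₀ a≡true b≡true c proper
        boundary : ∀ v → InBd H r v → ∃ λ u → f u ≡ v × InBd G₁ r₁ u
        boundary v bv with fg-cover v
        ... | inj₁ (u , refl) with exit-f bv
        ...   | inj₁ (u′ , ru′ , e) = u , refl , f-exit-in-G₁ (proj₁ bv) ru′ e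
        ...   | inj₂ (w , rw , _)   = ⊥-elim (true≢false (full₀ w) rw)
        boundary v bv | inj₂ (w , refl) with exit-g bv
        ...   | inj₂ (w′ , rw′ , _) = ⊥-elim (true≢false (full₀ w′) rw′)
        ...   | inj₁ (u′ , ru′ , e) with fg-edge-end (adj-sym H e)
        ...     | inj₁ refl = ⊥-elim (true≢false a≡true ru′)
        ...     | inj₂ refl = ⊥-elim (true≢false b≡true ru′)

      meets-both : (∃ λ u → r₁ u ≡ false) → (∃ λ w → r₀ w ≡ false) → Dichotomy H r
      meets-both nonmember₁ (w₁ , rw₁) = inj₂ (tt-both _ _ _
        (identity-at a≡true b≡true MI≡0 refl refl)
        (dichotomy⇒admissible G₁ r₁ (KYInvariant.pot-proper I₁ r₁ nonmember₁ (x , a≡true)))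
        (dichotomy⇒admissible G₂ r₂ (KYInvariant.pot-proper I₂ r₂ (p w₁ , trans (r₂-p w₁) rw₁) (z , z∈r₂))))

      dichotomy : (∃ λ v → r v ≡ false) → Dichotomy H r
      dichotomy nonmember with full-or-nonmember r₁ | full-or-nonmember r₀
      ... | inj₁ full₁      | inj₁ full₀      = ⊥-elim (r-not-full full₁ full₀ nonmember)
      ... | inj₁ full₁      | inj₂ nonmember₀ = G₁-whole full₁ nonmember₀
      ... | inj₂ nonmember₁ | inj₁ full₀      = G₂-whole full₀ nonmember₁
      ... | inj₂ nonmember₁ | inj₂ nonmember₀ = meets-both nonmember₁ nonmember₀

    -- Case x ∈ r, y ∉ r.  Here z ∈ r₂, x lies on the boundary of r₁, and the lost
    -- edges are those from z to r-vertices on y's side.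
    module OnlyX (a≡true : a ≡ true) (b≡false : b ≡ false) where
      z∈r₂ : r₂ z ≡ true
      z∈r₂ = trans r₂-z (o-true a≡true)

      restrict₁ : ∀ c → ProperOn H r c → ProperOn G₁ r₁ (c ∘ f)
      restrict₁ c proper = restrict-G₁ c proper λ _ b≡true → ⊥-elim (true≢false b≡true b≡false)

      x-exit : InBd G₁ r₁ x
      x-exit = a≡true , y , b≡false , xy-edge

      D₁ : Dichotomy G₁ r₁
      D₁ = KYInvariant.pot-proper I₁ r₁ (y , b≡false) (x , a≡true)

      y-neighbour-lost : ∀ {w} → r₀ w ≡ true → Adj H (g w) (f y) → lost w ≡ 1
      y-neighbour-lost rw e = lost-y-side a≡true b≡false rw (fg-edge-nbz (adj-sym H e)) (fg-edge-y-side (adj-sym H e))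

      f-boundary-colour : CollapsibleOn G₁ r₁ → ∀ c → ProperOn H r c → ∀ {u} → InBd H r (f u) →
                          (∀ w → Adj H (f u) (g w) → r₀ w ≡ false → c (f u) ≡ c (f x)) → c (f u) ≡ c (f x)
      f-boundary-colour collapsible₁ c proper {u} bu via-g with exit-f bu
      ... | inj₁ (u′ , ru′ , e) = collapsible₁ (c ∘ f) (restrict₁ c proper) u x (f-exit-in-G₁ (proj₁ bu) ru′ e)
                                                x-exit
      ... | inj₂ (w , rw , e)   = via-g w e rw

      -- r ⊇ V(G₂) - z and exactly one edge is lost: its endpoint w must take the
      -- colour of x, for otherwise z could take that colour and G₂ would be 4-coloured.
      sole-loss-colour : (∀ w → r₀ w ≡ true) → MI ≡ 1 → ∀ c → ProperOn H r c →
                         ∀ {w} → Adj H (g w) (f y) → c (g w) ≡ c (f x)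
      sole-loss-colour full₀ MI≡1 c proper {w} e with c (g w) ≟ c (f x)
      ... | yes same = same
      ... | no apart = ⊥-elim (KYInvariant.uncolourable I₂ (insertAt (c ∘ g) z (c (f x)))
              λ v v′ e′ → restrict-G₂ c (c (f x)) proper z-ok v v′ (full v) (full v′) e′)
        where
        full : ∀ v → r₂ v ≡ true
        full = r₂-full (o-true a≡true) full₀
        z-ok : ∀ w′ → r₀ w′ ≡ true → o ≡ true → Adj G₂ (p w′) z → c (g w′) ≢ c (f x)
        z-ok w′ rw′ _ e′ with side w′ in s
        ... | true = proper (g w′) (f x) rw′ a≡true (edge-to-x e′ s)
        ... | false with w′ ≟ w
        ...   | yes refl = apart
        ...   | no w′≢w  = ⊥-elim (at-most-one-loss a≡true b≡false MI≡1 w′≢w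
                             (lost-y-side a≡true b≡false rw′ e′ s) (y-neighbour-lost (full₀ w) e))

      G₂-whole : (∀ w → r₀ w ≡ true) → Dichotomy H r
      G₂-whole full₀ with some-loss a≡true b≡false full₀
      ... | k , MI≡ with tf-G₂-whole _ _ k (identity-at a≡true b≡false MI≡ refl
                            (pot-full I₂ r₂ (r₂-full (o-true a≡true) full₀))) (dichotomy⇒admissible G₁ r₁ D₁)
      ...   | inj₂ atLeast12 = inj₂ atLeast12
      ...   | inj₁ (pot≡9 , refl , P₁≡9) = inj₁ (pot≡9 , single-colour (λ c → c (f x)) boundary-colour)
        where
        boundary-colour : ∀ c → ProperOn H r c → ∀ v → InBd H r v → c v ≡ c (f x)
        boundary-colour c proper v bv with fg-cover v
        ... | inj₁ (u , refl) = f-boundary-colour (dichotomy-at-9 G₁ r₁ D₁ P₁≡9) c proper bv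
                                  λ w _ rw → ⊥-elim (true≢false (full₀ w) rw)
        ... | inj₂ (w , refl) with exit-g bv
        ...   | inj₂ (w′ , rw′ , _) = ⊥-elim (true≢false (full₀ w′) rw′)
        ...   | inj₁ (u′ , ru′ , e) with fg-edge-end (adj-sym H e)
        ...     | inj₁ refl = ⊥-elim (true≢false a≡true ru′)
        ...     | inj₂ refl = sole-loss-colour full₀ MI≡ c proper e

      -- r ⊉ V(G₂) - z (so r₂ ∋ z is a non-empty proper subset of V(G₂)): potential 9 forces P₁ = P₂ = 9 and no
      -- lost edge; then z (a boundary vertex of r₂) and x carry every boundary colour.
      D₂ : (∃ λ w → r₀ w ≡ false) → Dichotomy G₂ r₂
      D₂ (w₁ , rw₁) = KYInvariant.pot-proper I₂ r₂ (p w₁ , trans (r₂-p w₁) rw₁) (z , z∈r₂)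

      meets-both : (∃ λ w → r₀ w ≡ false) → Dichotomy H r
      meets-both nonmember₀
        with tf-both _ _ _ MI (identity-at a≡true b≡false refl refl refl)
               (dichotomy⇒admissible G₁ r₁ D₁) (dichotomy⇒admissible G₂ r₂ (D₂ nonmember₀))
      ... | inj₂ atLeast12 = inj₂ atLeast12
      ... | inj₁ (pot≡9 , P₁≡9 , P₂≡9 , MI≡0) = inj₁ (pot≡9 , single-colour (λ c → c (f x)) boundary-colour)
        where
        collapsible₂ : CollapsibleOn G₂ r₂
        collapsible₂ = dichotomy-at-9 G₂ r₂ (D₂ nonmember₀) P₂≡9
        no-loss : ∀ {w} → lost w ≡ 1 → ⊥
        no-loss {w} lost≡1 = 1≢0 (trans (sym lost≡1) (sum≡0⇒term≡0 lost MI≡0 w))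
        restrict₂ : ∀ c → ProperOn H r c → ProperOn G₂ r₂ (insertAt (c ∘ g) z (c (f x)))
        restrict₂ c proper = restrict-G₂ c (c (f x)) proper λ w rw _ e →
          proper (g w) (f x) rw a≡true (edge-to-x e (no-loss⇒x-side a≡true b≡false MI≡0 rw e))
        -- z keeps a neighbour on y's side, which cannot lie in r.
        z-boundary : InBd G₂ r₂ z
        z-boundary with z₂-pos
        ... | w , e , s with r₀ w in rw
        ...   | true  = ⊥-elim (no-loss (lost-y-side a≡true b≡false rw e s))
        ...   | false = z∈r₂ , p w , trans (r₂-p w) rw , adj-sym G₂ e
        boundary-colour : ∀ c → ProperOn H r c → ∀ v → InBd H r v → c v ≡ c (f x)
        boundary-colour c proper v bv with fg-cover v
        ... | inj₁ (u , refl) = f-boundary-colour (dichotomy-at-9 G₁ r₁ D₁ P₁≡9) c proper bv at-x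
          where
          at-x : ∀ w → Adj H (f u) (g w) → r₀ w ≡ false → c (f u) ≡ c (f x)
          at-x w e _ with fg-edge-end e
          ... | inj₁ refl = refl
          ... | inj₂ refl = ⊥-elim (true≢false (proj₁ bv) b≡false)
        ... | inj₂ (w , refl) with exit-g bv
        ...   | inj₂ (w′ , rw′ , e) = begin
          c (g w)                              ≡⟨ insertAt-punchIn (c ∘ g) z (c (f x)) w ⟨
          insertAt (c ∘ g) z (c (f x)) (p w)   ≡⟨ collapsible₂ _ (restrict₂ c proper) (p w) z
                                                    (g-exit-in-G₂ (proj₁ bv) rw′ e) z-boundary ⟩
          insertAt (c ∘ g) z (c (f x)) z       ≡⟨ insertAt-lookup (c ∘ g) z (c (f x)) ⟩
          c (f x)                              ∎
          where open ≡-Reasoning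
        ...   | inj₁ (u′ , ru′ , e) with fg-edge-end (adj-sym H e)
        ...     | inj₁ refl = ⊥-elim (true≢false a≡true ru′)
        ...     | inj₂ refl = ⊥-elim (no-loss (y-neighbour-lost (proj₁ bv) e))

      dichotomy : Dichotomy H r
      dichotomy with full-or-nonmember r₀
      ... | inj₁ full₀      = G₂-whole full₀
      ... | inj₂ nonmember₀ = meets-both nonmember₀

-- Which case applies depends on whether x, y lie in r;
-- the case x ∉ r ∋ y is the case x ∈ r ∌ y of the composition with x, y exchanged.
ore-invariant : ∀ {n₁ m n} {G₁ : Graph n₁} {G₂ : Graph (suc m)} {H : Graph n} →
                KYInvariant G₁ → KYInvariant G₂ → OreComp G₁ G₂ H → KYInvariant H
ore-invariant {H = H} I₁ I₂ oc = record
  { uncolourable = uncolourable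
  ; pot-whole    = Whole.pot-whole
  ; pot-proper   = pot-proper
  }
  where
  open OreGeometry oc using (x; y; f)
  module Cases = OreStep.Cases I₁ I₂ oc
  module Whole where
    open Cases (λ _ → true) public
    pot-whole : pot (adj H) (λ _ → true) ≡ + 5
    pot-whole = tt-whole _ (identity-at refl refl (MI≡0-both-in refl refl) (KYInvariant.pot-whole I₁)
                  (pot-full I₂ r₂ (r₂-full refl (λ _ → refl))))

  -- x and y would have to get both the same and different colours.
  uncolourable : ∀ c → (∀ u v → Adj H u v → c u ≢ c v) → ⊥
  uncolourable c proper = Whole.xy-differ (λ _ → refl) refl refl c proper′ (Whole.xy-same (λ _ → refl) c proper′)
    where
    proper′ : ProperOn H (λ _ → true) c
    proper′ u v _ _ = proper u v

  pot-proper : ∀ r → (∃ λ v → r v ≡ false) → (∃ λ v → r v ≡ true) → Dichotomy H r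
  pot-proper r nonmember member with r (f x) in a | r (f y) in b
  ... | true  | true  = Cases.BothIn.dichotomy r a b nonmember
  ... | true  | false = Cases.OnlyX.dichotomy r a b
  ... | false | true  = OreStep.Cases.OnlyX.dichotomy I₁ I₂ (OreComp-swap oc) r b a
  ... | false | false = Cases.BothOut.dichotomy r a b member

invariant : ∀ {n} {G : Graph n} → Is5Ore G → KYInvariant G
invariant (k5 G complete)  = K5-invariant G complete
invariant (ore o₁ o₂ oc)   = ore-invariant (invariant o₁) (invariant o₂) oc

∉⇒lookup-false : ∀ {n} (R : Subset n) {v} → v ∉ R → lookup R v ≡ false
∉⇒lookup-false R {v} v∉R = ¬-not λ eq → v∉R (lookup⇒[]= v R eq)

member-of-size : ∀ {n} (r : Fin n → Bool) → 1 ≤ size r → ∃ λ v → r v ≡ true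
member-of-size r 1≤size with empty-or-member r
... | inj₂ member = member
... | inj₁ empty with subst (1 ≤_) (sum-zero _ (cong 𝟙 ∘ empty)) 1≤size
...   | ()

below-12 : ∀ {P} → P < + 12 → ¬ AtLeast12 P
below-12 P<12 (d , refl) = <⇒≱ P<12 (i≤i+j (+ 12) (+ d))

collapsible-lookup : ∀ {n} (G : Graph n) (R : Subset n) → CollapsibleOn G (lookup R) →
  ∀ c → Proper4ColoringOf G R c → ∀ u v → InBoundary G R u → InBoundary G R v → c u ≡ c v
collapsible-lookup G R collapsible c proper u v bu bv = collapsible c proper′ u v (bd bu) (bd bv)
  where
  proper′ : ProperOn G (lookup R) c
  proper′ u v ru rv = proper u v (lookup⇒[]= u R ru) (lookup⇒[]= v R rv)
  bd : ∀ {u} → InBoundary G R u → InBd G (lookup R) u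
  bd (u∈R , w , w∉R , e) = []=⇒lookup u∈R , w , ∉⇒lookup-false R w∉R , e

lemma3p13 : ∀ {n} (G : Graph n) (R : Subset n) → Is5Ore G →
    R ⊂ ⊤ → 5 ≤ ∣ R ∣ → pKY G R < + 12 →
    Collapsible G R × pKY G R ≡ + 9
lemma3p13 G R is5Ore R⊂⊤ 5≤∣R∣ pKY<12
  with KYInvariant.pot-proper (invariant is5Ore) (lookup R) nonmember member
  where
  nonmember : ∃ λ v → lookup R v ≡ false
  nonmember = let (_ , v , _ , v∉R) = R⊂⊤ in v , ∉⇒lookup-false R v∉R
  member : ∃ λ v → lookup R v ≡ true
  member = member-of-size (lookup R) (≤-trans (s≤s z≤n) (subst (5 ≤_) (size-lookup R) 5≤∣R∣))
... | inj₂ atLeast12 = ⊥-elim (below-12 pKY<12 (subst AtLeast12 (sym (pKY≡pot G R)) atLeast12))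
... | inj₁ (pot≡9 , collapsible) =
  (R⊂⊤ , 5≤∣R∣ , collapsible-lookup G R collapsible) , trans (pKY≡pot G R) pot≡9
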